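{- Let $\Gamma$ be an Euler graph with adjacency matrix $A$ and let $N\geqslant 4$ be an even integer. Then $$\operatorname{tr}(A^N)\equiv -\sum_{\substack{d\mid N\\ d\neq N}}\varphi(N/d)\operatorname{tr}(A^d)\pmod{2N}.$$
   Context: An Euler graph is a (simple) graph in which every vertex has even degree. $\varphi$ is Euler's totient function. -}

module Defs where

open import Data.Nat using (ℕ; zero; suc; _+_; _*_; _∸_)
open import Data.Nat.Divisibility using (_∣_; _∣?_)
open import Data.Nat.GCD using (gcd)
open import Data.Nat.Properties using (_≟_)
open import Data.Bool using (Bool; true; false; if_then_else_; T)
open import Data.Bool.Properties using (T?)
open import Data.Fin using (Fin)
import Data.Fin.Properties as FinP
open import Data.List using (List; filter; map; length; allFin; applyUpTo)
open import Data.Nat.ListAction using (sum)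
open import Data.Nat using (_/_)
open import Relation.Nullary.Decidable using (⌊_⌋)
open import Relation.Binary.PropositionalEquality using (_≡_)

record SimpleGraph (n : ℕ) : Set where
  field
    Adj      : Fin n → Fin n → Bool
    sym      : ∀ i j → Adj i j ≡ Adj j i
    loopless : ∀ i → Adj i i ≡ false

open SimpleGraph public

degree : ∀ {n} → SimpleGraph n → Fin n → ℕ
degree {n} G v = length (filter (λ w → T? (Adj G v w)) (allFin n))

IsEuler : ∀ {n} → SimpleGraph n → Set
IsEuler {n} G = ∀ v → 2 ∣ degree G v

Matrix : ℕ → Set
Matrix n = Fin n → Fin n → ℕ

adjMatrix : ∀ {n} → SimpleGraph n → Matrix n
adjMatrix G i j = if Adj G i j then 1 else 0

identity : ∀ {n} → Matrix n
identity i j = if ⌊ i FinP.≟ j ⌋ then 1 else 0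

_⊗_ : ∀ {n} → Matrix n → Matrix n → Matrix n
_⊗_ {n} M P i j = sum (map (λ k → M i k * P k j) (allFin n))

_^ᴹ_ : ∀ {n} → Matrix n → ℕ → Matrix n
M ^ᴹ zero  = identity
M ^ᴹ suc k = M ⊗ (M ^ᴹ k)

trace : ∀ {n} → Matrix n → ℕ
trace {n} M = sum (map (λ i → M i i) (allFin n))

φ : ℕ → ℕ
φ m = length (filter (λ k → gcd k m ≟ 1) (applyUpTo suc m))

-- Sum over the divisors d of N with d ≠ N (for N ≥ 1 these are the
-- d with 1 ≤ d ≤ N - 1 and d ∣ N) of  f d (N / d).
-- Divisors are enumerated as  suc k  so that  N / suc k  needs no proof.
properDivisorSum : ℕ → (ℕ → ℕ → ℕ) → ℕ
properDivisorSum N f =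
  sum (map (λ k → f (suc k) (N / suc k))
           (filter (λ k → suc k ∣? N) (applyUpTo (λ k → k) (N ∸ 1))))

module Submission where

-- Closed walks of length N in Γ are words x : ℤ/N → V with x(i) ~ x(i + 1). The dihedral group of
-- order 2N acts on them (reflections preserve them since adjacency is symmetric), so by Burnside's
-- lemma the number of pairs (g, x) with g·x = x is a multiple of 2N. A rotation by k fixes exactly
-- the closed walks of period gcd(k, N), which are counted by tr(A^gcd(k,N)); grouping the k by
-- d = gcd(k, N) turns the rotations' share into tr(A^N) + Σ_{d ∣ N, d ≠ N} φ(N/d) tr(A^d).
-- For N = 2M, a reflection i ↦ a − i with a odd fixes no closed walk (it would contain a loop), and
-- one with a even fixes the palindromic closed walks, i.e. the unfolded walks x₀ … x_M. Counting
-- these by their second vertex l gives Σ_l deg(l) · #(walks of length M − 1 from l), and both factors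
-- are even for an Euler graph, so the reflections contribute M · 4t ≡ 0 (mod 2N).

open import Defs hiding (sym)
open import Data.Bool using (Bool; true; false; T; _xor_; if_then_else_)
import Data.Bool.Properties as Bool
open import Data.Empty using (⊥-elim)
open import Data.Fin as Fin using (Fin; toℕ; fromℕ<; fromℕ; inject₁)
import Data.Fin.Properties as Finₚ
open import Data.List using (List; []; _∷_; [_]; map; concatMap; length; _++_; allFin; filter; applyUpTo)
open import Data.List.Membership.Propositional using (_∈_)
import Data.List.Properties as List
import Data.List.Relation.Unary.All as All
open import Data.List.Relation.Unary.Any using (here; there)
open import Data.Nat using (ℕ; zero; suc; _+_; _*_; _∸_; _≤_; _<_; _≥_; _<?_; _/_; _%_; _⊓_; z≤n; s≤s; z<s; s≤s⁻¹; NonZero; >-nonZero)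
open import Data.Nat.Divisibility using (_∣_; _∣?_; divides; ∣-refl; ∣-antisym; ∣m∣n⇒∣m+n; ∣n⇒∣m*n; *-pres-∣; ∣m+n∣m⇒∣n; ∣⇒≤)
open import Data.Nat.DivMod
open import Data.Nat.GCD using (gcd; gcd[m,n]∣m; gcd[m,n]∣n; gcd[m,n]≢0; gcd-GCD; gcd-greatest; gcd-identityˡ; c*gcd[m,n]≡gcd[cm,cn]; module Bézout)
open import Data.Nat.ListAction using (sum)
open import Data.Nat.ListAction.Properties using (sum-++)
open import Data.Nat.Properties
open import Algebra.Properties.CommutativeSemigroup +-commutativeSemigroup using (interchange)
open import Data.List.Extrema ≤-totalOrder using (argmin; f[argmin]≤f[xs])
open import Data.Nat.Tactic.RingSolver using (solve-∀)
open import Data.Product using (Σ; Σ-syntax; _×_; _,_)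
import Data.Product.Properties as Product
open import Data.Sum using (_⊎_; inj₁; inj₂)
open import Data.Unit using (⊤; tt)
open import Data.Vec as Vec using (Vec)
import Data.Vec.Properties as Vecₚ
open import Relation.Binary using (DecidableEquality)
open import Relation.Binary.PropositionalEquality using (_≡_; refl; sym; trans; cong; cong₂; subst; subst₂; module ≡-Reasoning)
open import Relation.Nullary using (Dec; yes; no; ¬_)
open import Relation.Nullary.Decidable using (_×-dec_)

private
  variable
    X Y : Set

∑ : List X → (X → ℕ) → ℕ
∑ L f = sum (map f L)

syntax ∑ L (λ x → e) = ∑[ x ∈ L ] e

∑-cong : (L : List X) {f g : X → ℕ} → (∀ x → f x ≡ g x) → ∑ L f ≡ ∑ L g
∑-cong []      f≗g = refl
∑-cong (x ∷ L) f≗g = cong₂ _+_ (f≗g x) (∑-cong L f≗g)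

∑-distrib-+ : (L : List X) (f g : X → ℕ) → ∑[ x ∈ L ] (f x + g x) ≡ ∑ L f + ∑ L g
∑-distrib-+ []      f g = refl
∑-distrib-+ (x ∷ L) f g =
  trans (cong (f x + g x +_) (∑-distrib-+ L f g)) (interchange (f x) (g x) (∑ L f) (∑ L g))

∑-*ˡ : (L : List X) (c : ℕ) (f : X → ℕ) → ∑[ x ∈ L ] (c * f x) ≡ c * ∑ L f
∑-*ˡ []      c f = sym (*-zeroʳ c)
∑-*ˡ (x ∷ L) c f = trans (cong (c * f x +_) (∑-*ˡ L c f)) (sym (*-distribˡ-+ c (f x) (∑ L f)))

∑-*ʳ : (L : List X) (c : ℕ) (f : X → ℕ) → ∑[ x ∈ L ] (f x * c) ≡ ∑ L f * c
∑-*ʳ L c f = trans (∑-cong L (λ x → *-comm (f x) c)) (trans (∑-*ˡ L c f) (*-comm c (∑ L f)))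

∑-const : (L : List X) (c : ℕ) → ∑[ _ ∈ L ] c ≡ length L * c
∑-const []      c = refl
∑-const (x ∷ L) c = cong (c +_) (∑-const L c)

∑-zero : (L : List X) (f : X → ℕ) → (∀ x → f x ≡ 0) → ∑ L f ≡ 0
∑-zero L f f≗0 = trans (∑-cong L f≗0) (trans (∑-const L 0) (*-zeroʳ (length L)))

∑-map : (L : List X) (g : X → Y) (f : Y → ℕ) → ∑ (map g L) f ≡ ∑[ x ∈ L ] f (g x)
∑-map L g f = cong sum (sym (List.map-∘ L))

∑-concatMap : (L : List X) (h : X → List Y) (f : Y → ℕ) →
              ∑ (concatMap h L) f ≡ ∑[ x ∈ L ] ∑ (h x) f
∑-concatMap []      h f = refl
∑-concatMap (x ∷ L) h f = begin
  sum (map f (h x ++ concatMap h L))         ≡⟨ cong sum (List.map-++ f (h x) (concatMap h L)) ⟩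
  sum (map f (h x) ++ map f (concatMap h L)) ≡⟨ sum-++ (map f (h x)) _ ⟩
  ∑ (h x) f + ∑ (concatMap h L) f            ≡⟨ cong (∑ (h x) f +_) (∑-concatMap L h f) ⟩
  ∑ (h x) f + ∑[ y ∈ L ] ∑ (h y) f           ∎
  where open ≡-Reasoning

∑-comm : (L : List X) (K : List Y) (F : X → Y → ℕ) →
         ∑[ x ∈ L ] ∑[ y ∈ K ] F x y ≡ ∑[ y ∈ K ] ∑[ x ∈ L ] F x y
∑-comm []      K F = sym (∑-zero K _ (λ _ → refl))
∑-comm (x ∷ L) K F =
  trans (cong (∑ K (F x) +_) (∑-comm L K F)) (sym (∑-distrib-+ K (F x) (λ y → ∑[ x ∈ L ] F x y)))

∣-∑ : ∀ {d} (L : List X) (f : X → ℕ) → (∀ x → d ∣ f x) → d ∣ ∑ L f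
∣-∑ []      f d∣f = divides 0 refl
∣-∑ (x ∷ L) f d∣f = ∣m∣n⇒∣m+n (d∣f x) (∣-∑ L f d∣f)

∑-allFin-suc : ∀ {n} (h : Fin (suc n) → ℕ) →
               ∑ (allFin (suc n)) h ≡ h Fin.zero + ∑[ i ∈ allFin n ] h (Fin.suc i)
∑-allFin-suc {n} h =
  cong (h Fin.zero +_) (trans (cong (λ l → ∑ l h) (sym (List.map-tabulate (λ i → i) Fin.suc))) (∑-map (allFin n) Fin.suc h))

∑-allFin-2-periodic : ∀ M (F : ℕ → ℕ) → (∀ a → F (2 + a) ≡ F a) →
                      ∑[ k ∈ allFin (M + M) ] F (toℕ k) ≡ M * (F 0 + F 1)
∑-allFin-2-periodic zero    F per = refl
∑-allFin-2-periodic (suc M) F per = begin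
  ∑[ k ∈ allFin (suc M + suc M) ] F (toℕ k)
    ≡⟨ cong (λ m → ∑[ k ∈ allFin (suc m) ] F (toℕ k)) (+-suc M M) ⟩
  ∑[ k ∈ allFin (2 + (M + M)) ] F (toℕ k)
    ≡⟨ ∑-allFin-suc {suc (M + M)} (λ k → F (toℕ k)) ⟩
  F 0 + ∑[ k ∈ allFin (1 + (M + M)) ] F (suc (toℕ k))
    ≡⟨ cong (F 0 +_) (∑-allFin-suc {M + M} (λ k → F (suc (toℕ k)))) ⟩
  F 0 + (F 1 + ∑[ k ∈ allFin (M + M) ] F (2 + toℕ k))
    ≡⟨ cong (λ z → F 0 + (F 1 + z)) (trans (∑-cong (allFin (M + M)) (λ k → per (toℕ k))) (∑-allFin-2-periodic M F per)) ⟩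
  F 0 + (F 1 + M * (F 0 + F 1))
    ≡⟨ +-assoc (F 0) (F 1) _ ⟨
  F 0 + F 1 + M * (F 0 + F 1) ∎
  where open ≡-Reasoning

∑-applyUpTo : (f : ℕ → X) (m : ℕ) (h : X → ℕ) → ∑ (applyUpTo f m) h ≡ ∑[ i ∈ allFin m ] h (f (toℕ i))
∑-applyUpTo f zero    h = refl
∑-applyUpTo f (suc m) h =
  trans (cong (h (f 0) +_) (∑-applyUpTo (λ k → f (suc k)) m h)) (sym (∑-allFin-suc {m} (λ i → h (f (toℕ i)))))

𝟙 : {P : Set} → Dec P → ℕ
𝟙 (yes _) = 1
𝟙 (no _)  = 0

𝟙-yes : {P : Set} (d : Dec P) → P → 𝟙 d ≡ 1
𝟙-yes (yes _) p = refl
𝟙-yes (no ¬p) p = ⊥-elim (¬p p)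

𝟙-no : {P : Set} (d : Dec P) → ¬ P → 𝟙 d ≡ 0
𝟙-no (yes p) ¬p = ⊥-elim (¬p p)
𝟙-no (no _)  ¬p = refl

𝟙-cong : {P Q : Set} (d : Dec P) (e : Dec Q) → (P → Q) → (Q → P) → 𝟙 d ≡ 𝟙 e
𝟙-cong (yes p) e P⇒Q Q⇒P = sym (𝟙-yes e (P⇒Q p))
𝟙-cong (no ¬p) e P⇒Q Q⇒P = sym (𝟙-no e (λ q → ¬p (Q⇒P q)))

𝟙-× : {P Q : Set} (p : Dec P) (q : Dec Q) → 𝟙 p * 𝟙 q ≡ 𝟙 (p ×-dec q)
𝟙-× (yes _) (yes _) = refl
𝟙-× (yes _) (no _)  = refl
𝟙-× (no _)  _       = refl

if-𝟙 : (b : Bool) → (if b then 1 else 0) ≡ 𝟙 (Bool.T? b)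
if-𝟙 true  = refl
if-𝟙 false = refl

∑-filter : {P : X → Set} (P? : ∀ x → Dec (P x)) (L : List X) (f : X → ℕ) →
           ∑ (filter P? L) f ≡ ∑[ x ∈ L ] (𝟙 (P? x) * f x)
∑-filter P? []      f = refl
∑-filter P? (x ∷ L) f with P? x
... | yes _ = cong₂ _+_ (sym (+-identityʳ (f x))) (∑-filter P? L f)
... | no _  = ∑-filter P? L f

length-filter : {P : X → Set} (P? : ∀ x → Dec (P x)) (L : List X) →
                length (filter P? L) ≡ ∑[ x ∈ L ] 𝟙 (P? x)
length-filter P? []      = refl
length-filter P? (x ∷ L) with P? x
... | yes _ = cong suc (length-filter P? L)
... | no _  = length-filter P? L

module Enumeration {A : Set} (_≟_ : DecidableEquality A) where

  δ : A → A → ℕ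
  δ x y = 𝟙 (x ≟ y)

  Enumerates : List A → Set
  Enumerates L = ∀ x → ∑[ y ∈ L ] δ y x ≡ 1

  δ-* : ∀ y x (h : A → ℕ) → δ y x * h y ≡ δ y x * h x
  δ-* y x h with y ≟ x
  ... | yes refl = refl
  ... | no _     = refl

  ∑-δ : (L : List A) → Enumerates L → ∀ x (h : A → ℕ) → ∑[ y ∈ L ] (δ y x * h y) ≡ h x
  ∑-δ L L-enum x h = begin
    ∑[ y ∈ L ] (δ y x * h y) ≡⟨ ∑-cong L (λ y → δ-* y x h) ⟩
    ∑[ y ∈ L ] (δ y x * h x) ≡⟨ ∑-*ʳ L (h x) (λ y → δ y x) ⟩
    ∑[ y ∈ L ] δ y x * h x   ≡⟨ cong (_* h x) (L-enum x) ⟩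
    1 * h x                  ≡⟨ *-identityˡ (h x) ⟩
    h x                      ∎
    where open ≡-Reasoning

  enumerates⇒∈ : (L : List A) → Enumerates L → ∀ x → x ∈ L
  enumerates⇒∈ L L-enum x = go L (L-enum x)
    where
    go : (L : List A) → ∑[ y ∈ L ] δ y x ≡ 1 → x ∈ L
    go []      ()
    go (y ∷ L) p with y ≟ x
    ... | yes refl = here refl
    ... | no _     = there (go L p)

open Enumeration using (Enumerates)

module Reindex {X Y : Set} (_≟X_ : DecidableEquality X) (_≟Y_ : DecidableEquality Y)
  (Xs : List X) (Ys : List Y) (Xs-enum : Enumerates _≟X_ Xs) (Ys-enum : Enumerates _≟Y_ Ys) where

  open Enumeration _≟X_ using () renaming (δ to δX; ∑-δ to ∑-δX)
  open Enumeration _≟Y_ using () renaming (δ to δY)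

  ∑-reindex : {P : X → Set} {Q : Y → Set} (P? : ∀ x → Dec (P x)) (Q? : ∀ y → Dec (Q y))
    (f : Y → X) (g : X → Y) →
    (∀ y → Q y → P (f y)) → (∀ y → Q y → g (f y) ≡ y) →
    (∀ x → P x → Q (g x)) → (∀ x → P x → f (g x) ≡ x) →
    (h : X → ℕ) → ∑[ x ∈ Xs ] (𝟙 (P? x) * h x) ≡ ∑[ y ∈ Ys ] (𝟙 (Q? y) * h (f y))
  ∑-reindex {P} {Q} P? Q? f g Pf gf Qg fg h = begin
    ∑[ x ∈ Xs ] (𝟙 (P? x) * h x)
      ≡⟨ ∑-cong Xs (λ x → sym (trans (cong (_* (𝟙 (P? x) * h x)) (Ys-enum (g x))) (+-identityʳ _))) ⟩
    ∑[ x ∈ Xs ] (∑[ y ∈ Ys ] δY y (g x) * (𝟙 (P? x) * h x))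
      ≡⟨ ∑-cong Xs (λ x → sym (∑-*ʳ Ys _ _)) ⟩
    ∑[ x ∈ Xs ] ∑[ y ∈ Ys ] (δY y (g x) * (𝟙 (P? x) * h x))
      ≡⟨ ∑-comm Xs Ys _ ⟩
    ∑[ y ∈ Ys ] ∑[ x ∈ Xs ] (δY y (g x) * (𝟙 (P? x) * h x))
      ≡⟨ ∑-cong Ys (λ y → ∑-cong Xs (λ x → both-sides-agree x y)) ⟩
    ∑[ y ∈ Ys ] ∑[ x ∈ Xs ] (𝟙 (Q? y) * (δX x (f y) * h x))
      ≡⟨ ∑-cong Ys (λ y → ∑-*ˡ Xs (𝟙 (Q? y)) _) ⟩
    ∑[ y ∈ Ys ] (𝟙 (Q? y) * ∑[ x ∈ Xs ] (δX x (f y) * h x))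
      ≡⟨ ∑-cong Ys (λ y → cong (𝟙 (Q? y) *_) (∑-δX Xs Xs-enum (f y) h)) ⟩
    ∑[ y ∈ Ys ] (𝟙 (Q? y) * h (f y)) ∎
    where
    open ≡-Reasoning
    both-sides-agree : ∀ x y → δY y (g x) * (𝟙 (P? x) * h x) ≡ 𝟙 (Q? y) * (δX x (f y) * h x)
    both-sides-agree x y with P? x | Q? y | y ≟Y g x | x ≟X f y
    ... | yes p | yes q | yes refl | yes _    = refl
    ... | yes p | yes q | yes refl | no x≢fy  = ⊥-elim (x≢fy (sym (fg x p)))
    ... | yes p | no ¬q | yes refl | _        = ⊥-elim (¬q (Qg x p))
    ... | yes p | yes q | no y≢gx  | yes refl = ⊥-elim (y≢gx (sym (gf y q)))
    ... | yes p | yes q | no _     | no _     = refl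
    ... | yes p | no _  | no _     | _        = refl
    ... | no ¬p | yes q | _        | yes refl = ⊥-elim (¬p (Pf y q))
    ... | no _  | yes _ | yes _    | no _     = refl
    ... | no _  | yes _ | no _     | no _     = refl
    ... | no _  | no _  | yes _    | _        = refl
    ... | no _  | no _  | no _     | _        = refl

  ∑-reindex-onto : {P : X → Set} (P? : ∀ x → Dec (P x)) (f : Y → X) (g : X → Y) →
    (∀ y → P (f y)) → (∀ y → g (f y) ≡ y) → (∀ x → P x → f (g x) ≡ x) →
    (h : X → ℕ) → ∑[ x ∈ Xs ] (𝟙 (P? x) * h x) ≡ ∑[ y ∈ Ys ] h (f y)
  ∑-reindex-onto P? f g Pf gf fg h =
    trans (∑-reindex {Q = λ _ → ⊤} P? (λ _ → yes tt) f g (λ y _ → Pf y) (λ y _ → gf y) (λ _ _ → tt) fg h)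
          (∑-cong Ys (λ y → +-identityʳ (h (f y))))

  ∑-bijection : (f : Y → X) (g : X → Y) → (∀ y → g (f y) ≡ y) → (∀ x → f (g x) ≡ x) →
    (h : X → ℕ) → ∑ Xs h ≡ ∑[ y ∈ Ys ] h (f y)
  ∑-bijection f g gf fg h =
    trans (∑-cong Xs (λ x → sym (+-identityʳ (h x))))
          (∑-reindex-onto {P = λ _ → ⊤} (λ _ → yes tt) f g (λ _ → tt) gf (λ x _ → fg x) h)

enumerates-allFin : ∀ n → Enumerates (Finₚ._≟_ {n}) (allFin n)
enumerates-allFin zero    ()
enumerates-allFin (suc n) x = trans (∑-allFin-suc (λ y → 𝟙 (y Finₚ.≟ x))) (split x)
  where
  split : (x : Fin (suc n)) → 𝟙 (Fin.zero Finₚ.≟ x) + ∑[ i ∈ allFin n ] 𝟙 (Fin.suc i Finₚ.≟ x) ≡ 1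
  split Fin.zero    = cong suc (∑-zero (allFin n) _ (λ i → 𝟙-no (Fin.suc i Finₚ.≟ Fin.zero) (λ ())))
  split (Fin.suc x) = cong₂ _+_
    (𝟙-no (Fin.zero Finₚ.≟ Fin.suc x) (λ ()))
    (trans (∑-cong (allFin n) (λ i → 𝟙-cong (Fin.suc i Finₚ.≟ Fin.suc x) (i Finₚ.≟ x) Finₚ.suc-injective (cong Fin.suc)))
           (enumerates-allFin n x))

∑-allFin-const : ∀ N c → ∑[ _ ∈ allFin N ] c ≡ N * c
∑-allFin-const N c = trans (∑-const (allFin N) c) (cong (_* c) (List.length-tabulate {n = N} (λ i → i)))

module Pairs {A B : Set} (_≟A_ : DecidableEquality A) (_≟B_ : DecidableEquality B) where

  _≟×_ : DecidableEquality (A × B)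
  _≟×_ = Product.≡-dec _≟A_ _≟B_

  open Enumeration _≟A_ using () renaming (δ to δA)
  open Enumeration _≟B_ using () renaming (δ to δB)
  open Enumeration _≟×_ using (δ)

  pairs : List A → List B → List (A × B)
  pairs L K = concatMap (λ a → map (a ,_) K) L

  ∑-pairs : (L : List A) (K : List B) (f : A × B → ℕ) → ∑ (pairs L K) f ≡ ∑[ a ∈ L ] ∑[ b ∈ K ] f (a , b)
  ∑-pairs L K f = trans (∑-concatMap L _ _) (∑-cong L (λ a → ∑-map K (a ,_) f))

  δ-, : ∀ a b a′ b′ → δ (a , b) (a′ , b′) ≡ δA a a′ * δB b b′
  δ-, a b a′ b′ = factor (a ≟A a′) (b ≟B b′)
    where
    factor : Dec (a ≡ a′) → Dec (b ≡ b′) → δ (a , b) (a′ , b′) ≡ δA a a′ * δB b b′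
    factor (yes refl) (yes refl) = trans (𝟙-yes _ refl) (sym (cong₂ _*_ (𝟙-yes (a ≟A a) refl) (𝟙-yes (b ≟B b) refl)))
    factor (yes refl) (no b≢b′)  = trans (𝟙-no _ λ { refl → b≢b′ refl })
                                         (sym (trans (cong (δA a a *_) (𝟙-no (b ≟B b′) b≢b′)) (*-zeroʳ (δA a a))))
    factor (no a≢a′)  _          = trans (𝟙-no _ λ { refl → a≢a′ refl })
                                         (sym (cong (_* δB b b′) (𝟙-no (a ≟A a′) a≢a′)))

  enumerates-pairs : (L : List A) (K : List B) → Enumerates _≟A_ L → Enumerates _≟B_ K → Enumerates _≟×_ (pairs L K)
  enumerates-pairs L K L-enum K-enum (a′ , b′) = begin
    ∑[ y ∈ pairs L K ] δ y (a′ , b′)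
      ≡⟨ ∑-pairs L K _ ⟩
    ∑[ a ∈ L ] ∑[ b ∈ K ] δ (a , b) (a′ , b′)
      ≡⟨ ∑-cong L (λ a → ∑-cong K (λ b → δ-, a b a′ b′)) ⟩
    ∑[ a ∈ L ] ∑[ b ∈ K ] (δA a a′ * δB b b′)
      ≡⟨ ∑-cong L (λ a → ∑-*ˡ K (δA a a′) _) ⟩
    ∑[ a ∈ L ] (δA a a′ * ∑[ b ∈ K ] δB b b′)
      ≡⟨ ∑-cong L (λ a → cong (δA a a′ *_) (K-enum b′)) ⟩
    ∑[ a ∈ L ] (δA a a′ * 1)
      ≡⟨ ∑-cong L (λ a → *-identityʳ _) ⟩
    ∑[ a ∈ L ] δA a a′
      ≡⟨ L-enum a′ ⟩
    1 ∎
    where open ≡-Reasoning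

module Vectors {A : Set} (_≟A_ : DecidableEquality A) where

  _≟ᵛ_ : ∀ {k} → DecidableEquality (Vec A k)
  _≟ᵛ_ = Vecₚ.≡-dec _≟A_

  open Enumeration _≟A_ using () renaming (δ to δA)

  vectors : List A → (k : ℕ) → List (Vec A k)
  vectors L zero    = [ Vec.[] ]
  vectors L (suc k) = concatMap (λ a → map (a Vec.∷_) (vectors L k)) L

  ∑-vectors : (L : List A) (k : ℕ) (f : Vec A (suc k) → ℕ) →
              ∑ (vectors L (suc k)) f ≡ ∑[ a ∈ L ] ∑[ v ∈ vectors L k ] f (a Vec.∷ v)
  ∑-vectors L k f = trans (∑-concatMap L _ _) (∑-cong L (λ a → ∑-map (vectors L k) (a Vec.∷_) f))

  δ-∷ : ∀ {k} a (v : Vec A k) a′ v′ → 𝟙 ((a Vec.∷ v) ≟ᵛ (a′ Vec.∷ v′)) ≡ δA a a′ * 𝟙 (v ≟ᵛ v′)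
  δ-∷ a v a′ v′ = factor (a ≟A a′) (v ≟ᵛ v′)
    where
    factor : Dec (a ≡ a′) → Dec (v ≡ v′) → 𝟙 ((a Vec.∷ v) ≟ᵛ (a′ Vec.∷ v′)) ≡ δA a a′ * 𝟙 (v ≟ᵛ v′)
    factor (yes refl) (yes refl) = trans (𝟙-yes _ refl) (sym (cong₂ _*_ (𝟙-yes (a ≟A a) refl) (𝟙-yes (v ≟ᵛ v) refl)))
    factor (yes refl) (no v≢v′)  = trans (𝟙-no _ λ { refl → v≢v′ refl })
                                         (sym (trans (cong (δA a a *_) (𝟙-no (v ≟ᵛ v′) v≢v′)) (*-zeroʳ (δA a a))))
    factor (no a≢a′)  _          = trans (𝟙-no _ λ { refl → a≢a′ refl })
                                         (sym (cong (_* 𝟙 (v ≟ᵛ v′)) (𝟙-no (a ≟A a′) a≢a′)))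

  enumerates-vectors : (L : List A) → Enumerates _≟A_ L → (k : ℕ) → Enumerates (_≟ᵛ_ {k}) (vectors L k)
  enumerates-vectors L L-enum zero    Vec.[] = refl
  enumerates-vectors L L-enum (suc k) (a′ Vec.∷ v′) = begin
    ∑[ y ∈ vectors L (suc k) ] 𝟙 (y ≟ᵛ (a′ Vec.∷ v′))
      ≡⟨ ∑-vectors L k _ ⟩
    ∑[ a ∈ L ] ∑[ v ∈ vectors L k ] 𝟙 ((a Vec.∷ v) ≟ᵛ (a′ Vec.∷ v′))
      ≡⟨ ∑-cong L (λ a → ∑-cong (vectors L k) (λ v → δ-∷ a v a′ v′)) ⟩
    ∑[ a ∈ L ] ∑[ v ∈ vectors L k ] (δA a a′ * 𝟙 (v ≟ᵛ v′))
      ≡⟨ ∑-cong L (λ a → ∑-*ˡ (vectors L k) (δA a a′) _) ⟩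
    ∑[ a ∈ L ] (δA a a′ * ∑[ v ∈ vectors L k ] 𝟙 (v ≟ᵛ v′))
      ≡⟨ ∑-cong L (λ a → cong (δA a a′ *_) (enumerates-vectors L L-enum k v′)) ⟩
    ∑[ a ∈ L ] (δA a a′ * 1)
      ≡⟨ ∑-cong L (λ a → *-identityʳ _) ⟩
    ∑[ a ∈ L ] δA a a′
      ≡⟨ L-enum a′ ⟩
    1 ∎
    where open ≡-Reasoning

toℕ-mod : ∀ a m .{{_ : NonZero m}} → toℕ (a mod m) ≡ a % m
toℕ-mod a m = Finₚ.toℕ-fromℕ< (m%n<n a m)

module Modular (P : ℕ) where

  N : ℕ
  N = suc P

  infix 4 _≈_
  record _≈_ (a b : ℕ) : Set where
    constructor mk≈
    field get : a % N ≡ b % N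
  open _≈_ public

  ≈-refl : ∀ {a} → a ≈ a
  ≈-refl = mk≈ refl

  ≈-sym : ∀ {a b} → a ≈ b → b ≈ a
  ≈-sym (mk≈ p) = mk≈ (sym p)

  ≈-trans : ∀ {a b c} → a ≈ b → b ≈ c → a ≈ c
  ≈-trans (mk≈ p) (mk≈ q) = mk≈ (trans p q)

  ≡⇒≈ : ∀ {a b} → a ≡ b → a ≈ b
  ≡⇒≈ refl = ≈-refl

  ≈-+ : ∀ {a a′ b b′} → a ≈ a′ → b ≈ b′ → a + b ≈ a′ + b′
  ≈-+ {a} {a′} {b} {b′} (mk≈ p) (mk≈ q) = mk≈ (begin
    (a + b) % N            ≡⟨ %-distribˡ-+ a b N ⟩
    (a % N + b % N) % N    ≡⟨ cong₂ (λ u v → (u + v) % N) p q ⟩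
    (a′ % N + b′ % N) % N  ≡⟨ %-distribˡ-+ a′ b′ N ⟨
    (a′ + b′) % N          ∎)
    where open ≡-Reasoning

  ≈-* : ∀ {a a′ b b′} → a ≈ a′ → b ≈ b′ → a * b ≈ a′ * b′
  ≈-* {a} {a′} {b} {b′} (mk≈ p) (mk≈ q) = mk≈ (begin
    (a * b) % N              ≡⟨ %-distribˡ-* a b N ⟩
    (a % N * (b % N)) % N    ≡⟨ cong₂ (λ u v → (u * v) % N) p q ⟩
    (a′ % N * (b′ % N)) % N  ≡⟨ %-distribˡ-* a′ b′ N ⟨
    (a′ * b′) % N            ∎)
    where open ≡-Reasoning

  %-≈ : ∀ a → a % N ≈ a
  %-≈ a = mk≈ (m%n%n≡m%n a N)

  ≈-intro : ∀ a b s t → a + s * N ≡ b + t * N → a ≈ b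
  ≈-intro a b s t eq = mk≈ (trans (sym ([m+kn]%n≡m%n a s N)) (trans (cong (_% N) eq) ([m+kn]%n≡m%n b t N)))

  ≡+*N⇒≈ : ∀ a b t → a ≡ b + t * N → a ≈ b
  ≡+*N⇒≈ a b t eq = ≈-intro a b 0 t (trans (+-identityʳ a) eq)

  mod-≈ : ∀ a → toℕ (a mod N) ≈ a
  mod-≈ a = ≈-trans (≡⇒≈ (toℕ-mod a N)) (%-≈ a)

  ≈⇒mod≡ : ∀ a (k : Fin N) → a ≈ toℕ k → a mod N ≡ k
  ≈⇒mod≡ a k p = Finₚ.toℕ-injective (trans (toℕ-mod a N) (trans (get p) (m<n⇒m%n≡m (Finₚ.toℕ<n k))))

  toℕ-mod-N : (k : Fin N) → toℕ k mod N ≡ k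
  toℕ-mod-N k = ≈⇒mod≡ (toℕ k) k ≈-refl

  module _ {A : Set} where

    infixl 10 _‼_
    _‼_ : Vec A N → ℕ → A
    x ‼ a = Vec.lookup x (a mod N)

    ‼-cong : (x : Vec A N) {a b : ℕ} → a ≈ b → x ‼ a ≡ x ‼ b
    ‼-cong x {a} {b} p =
      cong (Vec.lookup x) (Finₚ.toℕ-injective (trans (toℕ-mod a N) (trans (get p) (sym (toℕ-mod b N)))))

    ‼-toℕ : (x : Vec A N) (i : Fin N) → x ‼ toℕ i ≡ Vec.lookup x i
    ‼-toℕ x i = cong (Vec.lookup x) (toℕ-mod-N i)

    tabulateℕ : (ℕ → A) → Vec A N
    tabulateℕ f = Vec.tabulate (λ i → f (toℕ i))

    ‼-tabulateℕ : (f : ℕ → A) (a : ℕ) → tabulateℕ f ‼ a ≡ f (a % N)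
    ‼-tabulateℕ f a = trans (Vecₚ.lookup∘tabulate (λ i → f (toℕ i)) (a mod N)) (cong f (toℕ-mod a N))

    ‼-tabulateℕ-≈ : (f : ℕ → A) → (∀ a b → a ≈ b → f a ≡ f b) → (a : ℕ) → tabulateℕ f ‼ a ≡ f a
    ‼-tabulateℕ-≈ f f-cong a = trans (‼-tabulateℕ f a) (f-cong _ _ (%-≈ a))

    ‼-ext : (x y : Vec A N) → (∀ a → x ‼ a ≡ y ‼ a) → x ≡ y
    ‼-ext x y x≗y = trans (sym (Vecₚ.tabulate∘lookup x))
      (trans (Vecₚ.tabulate-cong (λ i → trans (sym (‼-toℕ x i)) (trans (x≗y (toℕ i)) (‼-toℕ y i))))
             (Vecₚ.tabulate∘lookup y))

record GroupAction (G X : Set) : Set where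
  field
    _∙_      : G → G → G
    inv      : G → G
    e        : G
    act      : G → X → X
    inverseˡ : ∀ g h → inv g ∙ (g ∙ h) ≡ h
    inverseʳ : ∀ g h → g ∙ (inv g ∙ h) ≡ h
    act-e    : ∀ x → act e x ≡ x
    act-∙    : ∀ g h x → act (g ∙ h) x ≡ act g (act h x)

  act-inverseˡ : ∀ g x → act (inv g) (act g x) ≡ x
  act-inverseˡ g x = begin
    act (inv g) (act g x)         ≡⟨ cong (λ y → act (inv g) (act g y)) (act-e x) ⟨
    act (inv g) (act g (act e x)) ≡⟨ cong (act (inv g)) (act-∙ g e x) ⟨
    act (inv g) (act (g ∙ e) x)   ≡⟨ act-∙ (inv g) (g ∙ e) x ⟨
    act (inv g ∙ (g ∙ e)) x       ≡⟨ cong (λ h → act h x) (inverseˡ g e) ⟩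
    act e x                       ≡⟨ act-e x ⟩
    x                             ∎
    where open ≡-Reasoning

  act-inverseʳ : ∀ g x → act g (act (inv g) x) ≡ x
  act-inverseʳ g x = begin
    act g (act (inv g) x)         ≡⟨ cong (λ y → act g (act (inv g) y)) (act-e x) ⟨
    act g (act (inv g) (act e x)) ≡⟨ cong (act g) (act-∙ (inv g) e x) ⟨
    act g (act (inv g ∙ e) x)     ≡⟨ act-∙ g (inv g ∙ e) x ⟨
    act (g ∙ (inv g ∙ e)) x       ≡⟨ cong (λ h → act h x) (inverseʳ g e) ⟩
    act e x                       ≡⟨ act-e x ⟩
    x                             ∎
    where open ≡-Reasoning

module Burnside {G X : Set} (_≟G_ : DecidableEquality G) (_≟X_ : DecidableEquality X)
  (Gs : List G) (Xs : List X) (Gs-enum : Enumerates _≟G_ Gs) (Xs-enum : Enumerates _≟X_ Xs)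
  (𝒜 : GroupAction G X)
  (code : X → ℕ) (code-injective : ∀ x y → code x ≡ code y → x ≡ y)
  (w : X → ℕ) (w-invariant : ∀ g x → w (GroupAction.act 𝒜 g x) ≡ w x) where

  open GroupAction 𝒜
  module G⇔G = Reindex _≟G_ _≟G_ Gs Gs Gs-enum Gs-enum
  module X⇔X = Reindex _≟X_ _≟X_ Xs Xs Xs-enum Xs-enum

  minimiser : X → G
  minimiser x = argmin (λ g → code (act g x)) e Gs

  orbitMin : X → ℕ
  orbitMin x = code (act (minimiser x) x)

  orbitMin-≤ : ∀ x g → orbitMin x ≤ code (act g x)
  orbitMin-≤ x g =
    All.lookup (f[argmin]≤f[xs] {f = λ g → code (act g x)} e Gs) (Enumeration.enumerates⇒∈ _≟G_ Gs Gs-enum g)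

  orbitMin-invariant : ∀ h x → orbitMin (act h x) ≡ orbitMin x
  orbitMin-invariant h x = ≤-antisym
    (subst (λ y → orbitMin (act h x) ≤ code y)
           (trans (act-∙ j (inv h) (act h x)) (cong (act j) (act-inverseˡ h x)))
           (orbitMin-≤ (act h x) (j ∙ inv h)))
    (subst (λ y → orbitMin x ≤ code y) (act-∙ j′ h x) (orbitMin-≤ x (j′ ∙ h)))
    where
    j  = minimiser x
    j′ = minimiser (act h x)

  -- Every orbit is counted once, through its element of least code.
  weightedOrbitCount : ℕ
  weightedOrbitCount = ∑[ x ∈ Xs ] (w x * 𝟙 (code x ≟ orbitMin x))

  ∑-stabiliser : ∀ x → ∑[ g ∈ Gs ] 𝟙 (act g x ≟X x) ≡ ∑[ g ∈ Gs ] 𝟙 (code (act g x) ≟ orbitMin x)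
  ∑-stabiliser x = begin
    ∑[ g ∈ Gs ] 𝟙 (act g x ≟X x)
      ≡⟨ ∑-cong Gs (λ g → 𝟙-cong (act g x ≟X x) (code (act (j ∙ g) x) ≟ orbitMin x) fixed⇒min min⇒fixed) ⟩
    ∑[ g ∈ Gs ] 𝟙 (code (act (j ∙ g) x) ≟ orbitMin x)
      ≡⟨ G⇔G.∑-bijection (j ∙_) (inv j ∙_) (inverseˡ j) (inverseʳ j) (λ g → 𝟙 (code (act g x) ≟ orbitMin x)) ⟨
    ∑[ g ∈ Gs ] 𝟙 (code (act g x) ≟ orbitMin x) ∎
    where
    open ≡-Reasoning
    j = minimiser x
    fixed⇒min : ∀ {g} → act g x ≡ x → code (act (j ∙ g) x) ≡ orbitMin x
    fixed⇒min {g} gx≡x = cong code (trans (act-∙ j g x) (cong (act j) gx≡x))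
    min⇒fixed : ∀ {g} → code (act (j ∙ g) x) ≡ orbitMin x → act g x ≡ x
    min⇒fixed {g} eq = trans (sym (act-inverseˡ j (act g x)))
      (trans (cong (act (inv j)) (trans (sym (act-∙ j g x)) (code-injective _ _ eq))) (act-inverseˡ j x))

  burnside : ∑[ g ∈ Gs ] ∑[ x ∈ Xs ] (w x * 𝟙 (act g x ≟X x)) ≡ length Gs * weightedOrbitCount
  burnside = begin
    ∑[ g ∈ Gs ] ∑[ x ∈ Xs ] (w x * 𝟙 (act g x ≟X x))
      ≡⟨ ∑-comm Gs Xs _ ⟩
    ∑[ x ∈ Xs ] ∑[ g ∈ Gs ] (w x * 𝟙 (act g x ≟X x))
      ≡⟨ ∑-cong Xs (λ x → trans (∑-*ˡ Gs (w x) _) (trans (cong (w x *_) (∑-stabiliser x)) (sym (∑-*ˡ Gs (w x) _)))) ⟩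
    ∑[ x ∈ Xs ] ∑[ g ∈ Gs ] (w x * 𝟙 (code (act g x) ≟ orbitMin x))
      ≡⟨ ∑-comm Xs Gs _ ⟩
    ∑[ g ∈ Gs ] ∑[ x ∈ Xs ] (w x * 𝟙 (code (act g x) ≟ orbitMin x))
      ≡⟨ ∑-cong Gs translate ⟩
    ∑[ _ ∈ Gs ] weightedOrbitCount
      ≡⟨ ∑-const Gs weightedOrbitCount ⟩
    length Gs * weightedOrbitCount ∎
    where
    open ≡-Reasoning
    translate : ∀ g → ∑[ x ∈ Xs ] (w x * 𝟙 (code (act g x) ≟ orbitMin x)) ≡ weightedOrbitCount
    translate g = begin
      ∑[ x ∈ Xs ] (w x * 𝟙 (code (act g x) ≟ orbitMin x))
        ≡⟨ ∑-cong Xs (λ x → cong₂ (λ a b → a * 𝟙 (code (act g x) ≟ b)) (sym (w-invariant g x)) (sym (orbitMin-invariant g x))) ⟩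
      ∑[ x ∈ Xs ] (w (act g x) * 𝟙 (code (act g x) ≟ orbitMin (act g x)))
        ≡⟨ X⇔X.∑-bijection (act g) (act (inv g)) (act-inverseˡ g) (act-inverseʳ g) (λ u → w u * 𝟙 (code u ≟ orbitMin u)) ⟨
      weightedOrbitCount ∎

Bools : List Bool
Bools = false ∷ true ∷ []

enumerates-Bools : Enumerates Bool._≟_ Bools
enumerates-Bools false = refl
enumerates-Bools true  = refl

-- (false , k) is the rotation i ↦ k + i and (true , k) the reflection i ↦ k − i of ℤ/N;
-- −1 is represented by P = N − 1.
module Dihedral (P : ℕ) where

  open Modular P

  D : Set
  D = Bool × Fin N

  slope : Bool → ℕ
  slope false = 1
  slope true  = P

  ⟦_⟧ : D → ℕ → ℕ
  ⟦ b , k ⟧ i = toℕ k + slope b * i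

  ⟦⟧-cong : ∀ g {a a′} → a ≈ a′ → ⟦ g ⟧ a ≈ ⟦ g ⟧ a′
  ⟦⟧-cong (b , k) a≈a′ = ≈-+ (≈-refl {toℕ k}) (≈-* (≈-refl {slope b}) a≈a′)

  slope-xor : ∀ b b′ → slope (b xor b′) ≈ slope b′ * slope b
  slope-xor false false = ≈-refl
  slope-xor false true  = ≡⇒≈ (sym (*-identityʳ P))
  slope-xor true  false = ≡⇒≈ (sym (+-identityʳ P))
  slope-xor true  true  = ≈-sym (≈-intro (P * P) 1 2 N (ring P))
    where
    ring : ∀ p → p * p + 2 * suc p ≡ 1 + suc p * suc p
    ring = solve-∀

  _∙_ : D → D → D
  (b , k) ∙ (b′ , k′) = (b xor b′ , (toℕ k′ + slope b′ * toℕ k) mod N)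

  ⟦⟧-∙ : ∀ g h a → ⟦ g ∙ h ⟧ a ≈ ⟦ h ⟧ (⟦ g ⟧ a)
  ⟦⟧-∙ (b , k) (b′ , k′) a =
    ≈-trans (≈-+ (mod-≈ (toℕ k′ + slope b′ * toℕ k)) (≈-* (slope-xor b b′) (≈-refl {a})))
            (≡⇒≈ (ring (toℕ k′) (slope b′) (toℕ k) (slope b) a))
    where
    ring : ∀ K′ c′ K c a → K′ + c′ * K + c′ * c * a ≡ K′ + c′ * (K + c * a)
    ring = solve-∀

  inv : D → D
  inv (false , k) = (false , (P * toℕ k) mod N)
  inv (true  , k) = (true , k)

  e : D
  e = (false , Fin.zero)

  ,-mod : ∀ (b : Bool) (x : ℕ) (k : Fin N) → x ≈ toℕ k → (b , x mod N) ≡ (b , k)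
  ,-mod b x k x≈k = cong (b ,_) (≈⇒mod≡ x k x≈k)

  inverseˡ : ∀ g h → inv g ∙ (g ∙ h) ≡ h
  inverseˡ (false , k) (false , k′) = ,-mod false _ k′
    (≈-trans (≈-+ (mod-≈ (toℕ k′ + 1 * toℕ k)) (≈-* (≈-refl {1}) (mod-≈ (P * toℕ k))))
             (≡+*N⇒≈ _ _ (toℕ k) (ring (toℕ k′) (toℕ k) P)))
    where
    ring : ∀ K′ K p → K′ + 1 * K + 1 * (p * K) ≡ K′ + K * suc p
    ring = solve-∀
  inverseˡ (false , k) (true , k′) = ,-mod true _ k′
    (≈-trans (≈-+ (mod-≈ (toℕ k′ + P * toℕ k)) (≈-* (≈-refl {P}) (mod-≈ (P * toℕ k))))
             (≡+*N⇒≈ _ _ (P * toℕ k) (ring (toℕ k′) (toℕ k) P)))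
    where
    ring : ∀ K′ K p → K′ + p * K + p * (p * K) ≡ K′ + p * K * suc p
    ring = solve-∀
  inverseˡ (true , k) (false , k′) = ,-mod false _ k′
    (≈-trans (≈-+ (mod-≈ (toℕ k′ + 1 * toℕ k)) (≈-refl {P * toℕ k}))
             (≡+*N⇒≈ _ _ (toℕ k) (ring (toℕ k′) (toℕ k) P)))
    where
    ring : ∀ K′ K p → K′ + 1 * K + p * K ≡ K′ + K * suc p
    ring = solve-∀
  inverseˡ (true , k) (true , k′) = ,-mod true _ k′
    (≈-trans (≈-+ (mod-≈ (toℕ k′ + P * toℕ k)) (≈-refl {1 * toℕ k}))
             (≡+*N⇒≈ _ _ (toℕ k) (ring (toℕ k′) (toℕ k) P)))
    where
    ring : ∀ K′ K p → K′ + p * K + 1 * K ≡ K′ + K * suc p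
    ring = solve-∀

  inv-involutive : ∀ g → inv (inv g) ≡ g
  inv-involutive (false , k) = ,-mod false _ k
    (≈-trans (≈-* (≈-refl {P}) (mod-≈ (P * toℕ k))) (≈-intro _ _ (toℕ k) (P * toℕ k) (ring P (toℕ k))))
    where
    ring : ∀ p K → p * (p * K) + K * suc p ≡ K + p * K * suc p
    ring = solve-∀
  inv-involutive (true , k) = refl

  inverseʳ : ∀ g h → g ∙ (inv g ∙ h) ≡ h
  inverseʳ g h = subst (λ g′ → g′ ∙ (inv g ∙ h) ≡ h) (inv-involutive g) (inverseˡ (inv g) h)

  _≟D_ : DecidableEquality D
  _≟D_ = Pairs._≟×_ Bool._≟_ (Finₚ._≟_ {N})

  elements : List D
  elements = Pairs.pairs Bool._≟_ Finₚ._≟_ Bools (allFin N)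

  enumerates-elements : Enumerates _≟D_ elements
  enumerates-elements =
    Pairs.enumerates-pairs Bool._≟_ Finₚ._≟_ Bools (allFin N) enumerates-Bools (enumerates-allFin N)

  ∑-elements : (f : D → ℕ) →
    ∑ elements f ≡ ∑[ k ∈ allFin N ] f (false , k) + ∑[ k ∈ allFin N ] f (true , k)
  ∑-elements f =
    trans (Pairs.∑-pairs Bool._≟_ Finₚ._≟_ Bools (allFin N) f)
          (cong (∑[ k ∈ allFin N ] f (false , k) +_) (+-identityʳ _))

  length-elements : length elements ≡ 2 * N
  length-elements = begin
    length elements                                   ≡⟨ *-identityʳ _ ⟨
    length elements * 1                               ≡⟨ ∑-const elements 1 ⟨
    ∑[ _ ∈ elements ] 1                               ≡⟨ ∑-elements (λ _ → 1) ⟩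
    ∑[ _ ∈ allFin N ] 1 + ∑[ _ ∈ allFin N ] 1         ≡⟨ cong₂ _+_ (∑-allFin-const N 1) (∑-allFin-const N 1) ⟩
    N * 1 + N * 1                                     ≡⟨ ring N ⟩
    2 * N                                             ∎
    where
    open ≡-Reasoning
    ring : ∀ m → m * 1 + m * 1 ≡ 2 * m
    ring = solve-∀

  module Action {A : Set} where

    act : D → Vec A N → Vec A N
    act g x = tabulateℕ (λ i → x ‼ ⟦ g ⟧ i)

    ‼-act : ∀ g x a → act g x ‼ a ≡ x ‼ ⟦ g ⟧ a
    ‼-act g x = ‼-tabulateℕ-≈ (λ i → x ‼ ⟦ g ⟧ i) (λ a b a≈b → ‼-cong x (⟦⟧-cong g a≈b))

    act-e : ∀ x → act e x ≡ x
    act-e x = ‼-ext _ _ (λ a → trans (‼-act e x a) (cong (x ‼_) (+-identityʳ a)))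

    act-∙ : ∀ g h x → act (g ∙ h) x ≡ act g (act h x)
    act-∙ g h x = ‼-ext _ _ (λ a → begin
      act (g ∙ h) x ‼ a          ≡⟨ ‼-act (g ∙ h) x a ⟩
      x ‼ ⟦ g ∙ h ⟧ a            ≡⟨ ‼-cong x (⟦⟧-∙ g h a) ⟩
      x ‼ ⟦ h ⟧ (⟦ g ⟧ a)        ≡⟨ ‼-act h x (⟦ g ⟧ a) ⟨
      act h x ‼ ⟦ g ⟧ a          ≡⟨ ‼-act g (act h x) a ⟨
      act g (act h x) ‼ a        ∎)
      where open ≡-Reasoning

    dihedralAction : GroupAction D (Vec A N)
    dihedralAction = record
      { _∙_ = _∙_ ; inv = inv ; e = e ; act = act
      ; inverseˡ = inverseˡ ; inverseʳ = inverseʳ ; act-e = act-e ; act-∙ = act-∙ }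

encode : ∀ {n k} → Vec (Fin n) k → ℕ
encode Vec.[]            = 0
encode {n} (a Vec.∷ v) = toℕ a + n * encode v

encode-injective : ∀ {n k} (x y : Vec (Fin n) k) → encode x ≡ encode y → x ≡ y
encode-injective Vec.[] Vec.[] _ = refl
encode-injective {suc m} (a Vec.∷ x) (b Vec.∷ y) eq = cong₂ Vec._∷_ a≡b (encode-injective x y x≡y)
  where
  digit : ∀ (a : Fin (suc m)) c → (toℕ a + suc m * c) % suc m ≡ toℕ a
  digit a c = trans (cong (λ z → (toℕ a + z) % suc m) (*-comm (suc m) c))
                    (trans ([m+kn]%n≡m%n (toℕ a) c (suc m)) (m<n⇒m%n≡m (Finₚ.toℕ<n a)))
  a≡bℕ : toℕ a ≡ toℕ b
  a≡bℕ = trans (sym (digit a (encode x))) (trans (cong (_% suc m) eq) (digit b (encode y)))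
  a≡b : a ≡ b
  a≡b = Finₚ.toℕ-injective a≡bℕ
  x≡y : encode x ≡ encode y
  x≡y = *-cancelˡ-≡ (encode x) (encode y) (suc m)
          (+-cancelˡ-≡ (toℕ a) _ _ (trans eq (cong (_+ suc m * encode y) (sym a≡bℕ))))

lastView : ∀ {h} (p : Fin (suc h)) → (Σ (Fin h) λ q → p ≡ inject₁ q) ⊎ (p ≡ fromℕ h)
lastView {zero}  Fin.zero    = inj₂ refl
lastView {suc h} Fin.zero    = inj₁ (Fin.zero , refl)
lastView {suc h} (Fin.suc p) with lastView p
... | inj₁ (q , p≡q) = inj₁ (Fin.suc q , cong Fin.suc p≡q)
... | inj₂ p≡last   = inj₂ (cong Fin.suc p≡last)

module Walks {n : ℕ} (Γ : SimpleGraph n) where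

  open Vectors (Finₚ._≟_ {n})

  A : Matrix n
  A = adjMatrix Γ

  infix 4 _~_
  _~_ : Fin n → Fin n → Set
  i ~ j = T (Adj Γ i j)

  ~-sym : ∀ {i j} → i ~ j → j ~ i
  ~-sym {i} {j} = subst T (SimpleGraph.sym Γ i j)

  ~-irrefl : ∀ {i} → ¬ (i ~ i)
  ~-irrefl {i} i~i = subst T (SimpleGraph.loopless Γ i) i~i

  words : (k : ℕ) → List (Vec (Fin n) k)
  words = vectors (allFin n)

  enumerates-words : ∀ k → Enumerates _≟ᵛ_ (words k)
  enumerates-words = enumerates-vectors (allFin n) (enumerates-allFin n)

  walkWeight : ∀ {m} → Fin n → Vec (Fin n) m → Fin n → ℕ
  walkWeight i Vec.[]      j = A i j
  walkWeight i (l Vec.∷ u) j = A i l * walkWeight l u j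

  IsWalk : ∀ {m} → Fin n → Vec (Fin n) m → Fin n → Set
  IsWalk i Vec.[]      j = i ~ j
  IsWalk i (l Vec.∷ u) j = i ~ l × IsWalk l u j

  isWalk? : ∀ {m} i (u : Vec (Fin n) m) j → Dec (IsWalk i u j)
  isWalk? i Vec.[]      j = Bool.T? (Adj Γ i j)
  isWalk? i (l Vec.∷ u) j = Bool.T? (Adj Γ i l) ×-dec isWalk? l u j

  walkWeight≡𝟙 : ∀ {m} i (u : Vec (Fin n) m) j → walkWeight i u j ≡ 𝟙 (isWalk? i u j)
  walkWeight≡𝟙 i Vec.[]      j = if-𝟙 (Adj Γ i j)
  walkWeight≡𝟙 i (l Vec.∷ u) j =
    trans (cong₂ _*_ (if-𝟙 (Adj Γ i l)) (walkWeight≡𝟙 l u j)) (𝟙-× (Bool.T? (Adj Γ i l)) (isWalk? l u j))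

  ^ᴹ-suc≡∑-walks : ∀ m i j → (A ^ᴹ suc m) i j ≡ ∑[ u ∈ words m ] walkWeight i u j
  ^ᴹ-suc≡∑-walks zero i j = begin
    ∑[ k ∈ allFin n ] (A i k * identity k j)
      ≡⟨ ∑-cong (allFin n) (λ k → trans (cong (A i k *_) (identity≡δ k)) (*-comm (A i k) _)) ⟩
    ∑[ k ∈ allFin n ] (𝟙 (k Finₚ.≟ j) * A i k)
      ≡⟨ Enumeration.∑-δ Finₚ._≟_ (allFin n) (enumerates-allFin n) j (A i) ⟩
    A i j                                        ≡⟨ +-identityʳ _ ⟨
    A i j + 0 ∎
    where
    open ≡-Reasoning
    identity≡δ : ∀ k → identity k j ≡ 𝟙 (k Finₚ.≟ j)
    identity≡δ k with k Finₚ.≟ j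
    ... | yes _ = refl
    ... | no _  = refl
  ^ᴹ-suc≡∑-walks (suc m) i j = begin
    ∑[ l ∈ allFin n ] (A i l * (A ^ᴹ suc m) l j)
      ≡⟨ ∑-cong (allFin n) (λ l → cong (A i l *_) (^ᴹ-suc≡∑-walks m l j)) ⟩
    ∑[ l ∈ allFin n ] (A i l * ∑[ u ∈ words m ] walkWeight l u j)
      ≡⟨ ∑-cong (allFin n) (λ l → ∑-*ˡ (words m) (A i l) (λ u → walkWeight l u j)) ⟨
    ∑[ l ∈ allFin n ] ∑[ u ∈ words m ] (A i l * walkWeight l u j)
      ≡⟨ ∑-vectors (allFin n) m (λ u → walkWeight i u j) ⟨
    ∑[ u ∈ words (suc m) ] walkWeight i u j ∎
    where open ≡-Reasoning

  next : ∀ {m} → Vec (Fin n) (suc m) → Fin n → Fin (suc m) → Fin n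
  next (i Vec.∷ Vec.[])      j Fin.zero    = j
  next (i Vec.∷ l Vec.∷ u) j Fin.zero    = l
  next (i Vec.∷ l Vec.∷ u) j (Fin.suc p) = next (l Vec.∷ u) j p

  isWalk⇒steps : ∀ {m} i (u : Vec (Fin n) m) j → IsWalk i u j →
                 ∀ p → Vec.lookup (i Vec.∷ u) p ~ next (i Vec.∷ u) j p
  isWalk⇒steps i Vec.[]      j i~j       Fin.zero    = i~j
  isWalk⇒steps i (l Vec.∷ u) j (i~l , _) Fin.zero    = i~l
  isWalk⇒steps i (l Vec.∷ u) j (_ , w)   (Fin.suc p) = isWalk⇒steps l u j w p

  steps⇒isWalk : ∀ {m} i (u : Vec (Fin n) m) j →
                 (∀ p → Vec.lookup (i Vec.∷ u) p ~ next (i Vec.∷ u) j p) → IsWalk i u j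
  steps⇒isWalk i Vec.[]      j steps = steps Fin.zero
  steps⇒isWalk i (l Vec.∷ u) j steps = steps Fin.zero , steps⇒isWalk l u j (λ p → steps (Fin.suc p))

  next-inject₁ : ∀ {m} (z : Vec (Fin n) (suc m)) j (q : Fin m) → next z j (inject₁ q) ≡ Vec.lookup z (Fin.suc q)
  next-inject₁ (i Vec.∷ l Vec.∷ u) j Fin.zero    = refl
  next-inject₁ (i Vec.∷ l Vec.∷ u) j (Fin.suc q) = next-inject₁ (l Vec.∷ u) j q

  next-last : ∀ {m} (z : Vec (Fin n) (suc m)) j → next z j (fromℕ m) ≡ j
  next-last (i Vec.∷ Vec.[])      j = refl
  next-last (i Vec.∷ l Vec.∷ u) j = next-last (l Vec.∷ u) j

  pathWeight : ∀ {m} → Fin n → Vec (Fin n) m → ℕ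
  pathWeight i Vec.[]      = 1
  pathWeight i (l Vec.∷ u) = A i l * pathWeight l u

  IsPath : ∀ {m} → Fin n → Vec (Fin n) m → Set
  IsPath i Vec.[]      = ⊤
  IsPath i (l Vec.∷ u) = i ~ l × IsPath l u

  isPath? : ∀ {m} i (u : Vec (Fin n) m) → Dec (IsPath i u)
  isPath? i Vec.[]      = yes tt
  isPath? i (l Vec.∷ u) = Bool.T? (Adj Γ i l) ×-dec isPath? l u

  pathWeight≡𝟙 : ∀ {m} i (u : Vec (Fin n) m) → pathWeight i u ≡ 𝟙 (isPath? i u)
  pathWeight≡𝟙 i Vec.[]      = refl
  pathWeight≡𝟙 i (l Vec.∷ u) =
    trans (cong₂ _*_ (if-𝟙 (Adj Γ i l)) (pathWeight≡𝟙 l u)) (𝟙-× (Bool.T? (Adj Γ i l)) (isPath? l u))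

  isPath⇒steps : ∀ {m} i (u : Vec (Fin n) m) → IsPath i u →
                 ∀ t → Vec.lookup (i Vec.∷ u) (inject₁ t) ~ Vec.lookup (i Vec.∷ u) (Fin.suc t)
  isPath⇒steps i (l Vec.∷ u) (i~l , _) Fin.zero    = i~l
  isPath⇒steps i (l Vec.∷ u) (_ , p)   (Fin.suc t) = isPath⇒steps l u p t

  steps⇒isPath : ∀ {m} i (u : Vec (Fin n) m) →
                 (∀ t → Vec.lookup (i Vec.∷ u) (inject₁ t) ~ Vec.lookup (i Vec.∷ u) (Fin.suc t)) → IsPath i u
  steps⇒isPath i Vec.[]      steps = tt
  steps⇒isPath i (l Vec.∷ u) steps = steps Fin.zero , steps⇒isPath l u (λ t → steps (Fin.suc t))

  walksFrom : Fin n → ℕ → ℕ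
  walksFrom i k = ∑[ u ∈ words k ] pathWeight i u

  walksFrom-suc : ∀ i k → walksFrom i (suc k) ≡ ∑[ l ∈ allFin n ] (A i l * walksFrom l k)
  walksFrom-suc i k = trans (∑-vectors (allFin n) k (pathWeight i))
                            (∑-cong (allFin n) (λ l → ∑-*ˡ (words k) (A i l) (pathWeight l)))

  ∑-row≡degree : ∀ i → ∑[ l ∈ allFin n ] A i l ≡ degree Γ i
  ∑-row≡degree i = trans (∑-cong (allFin n) (λ l → if-𝟙 (Adj Γ i l)))
                         (sym (length-filter (λ l → Bool.T? (Adj Γ i l)) (allFin n)))

  ∑-column≡degree : ∀ l → ∑[ i ∈ allFin n ] A i l ≡ degree Γ l
  ∑-column≡degree l =
    trans (∑-cong (allFin n) (λ i → cong (λ b → if b then 1 else 0) (SimpleGraph.sym Γ i l))) (∑-row≡degree l)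

  module _ (euler : IsEuler Γ) where

    2∣walksFrom : ∀ i k → 2 ∣ walksFrom i (suc k)
    2∣walksFrom i zero = subst (2 ∣_)
      (sym (trans (walksFrom-suc i 0) (trans (∑-cong (allFin n) (λ l → *-identityʳ (A i l))) (∑-row≡degree i))))
      (euler i)
    2∣walksFrom i (suc k) = subst (2 ∣_) (sym (walksFrom-suc i (suc k)))
      (∣-∑ (allFin n) _ (λ l → ∣n⇒∣m*n (A i l) (2∣walksFrom l k)))

    4∣∑-walksFrom : ∀ k → 4 ∣ ∑[ i ∈ allFin n ] walksFrom i (suc (suc k))
    4∣∑-walksFrom k = subst (4 ∣_) (sym regroup)
      (∣-∑ (allFin n) _ (λ l → *-pres-∣ (euler l) (2∣walksFrom l k)))
      where
      regroup : ∑[ i ∈ allFin n ] walksFrom i (suc (suc k)) ≡ ∑[ l ∈ allFin n ] (degree Γ l * walksFrom l (suc k))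
      regroup = begin
        ∑[ i ∈ allFin n ] walksFrom i (suc (suc k))
          ≡⟨ ∑-cong (allFin n) (λ i → walksFrom-suc i (suc k)) ⟩
        ∑[ i ∈ allFin n ] ∑[ l ∈ allFin n ] (A i l * walksFrom l (suc k))
          ≡⟨ ∑-comm (allFin n) (allFin n) _ ⟩
        ∑[ l ∈ allFin n ] ∑[ i ∈ allFin n ] (A i l * walksFrom l (suc k))
          ≡⟨ ∑-cong (allFin n) (λ l → trans (∑-*ʳ (allFin n) (walksFrom l (suc k)) (λ i → A i l))
                                             (cong (_* walksFrom l (suc k)) (∑-column≡degree l))) ⟩
        ∑[ l ∈ allFin n ] (degree Γ l * walksFrom l (suc k)) ∎
        where open ≡-Reasoning

  module ClosedWalks (h : ℕ) where

    open Modular h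

    IsClosedWalk : Vec (Fin n) N → Set
    IsClosedWalk x = ∀ a → x ‼ a ~ x ‼ suc a

    -- The same condition quantified over Fin N only, so that it is decidable.
    IsClosedWalkᶠ : Vec (Fin n) N → Set
    IsClosedWalkᶠ x = ∀ (i : Fin N) → x ‼ toℕ i ~ x ‼ suc (toℕ i)

    isClosedWalkᶠ? : ∀ x → Dec (IsClosedWalkᶠ x)
    isClosedWalkᶠ? x = Finₚ.all? (λ i → Bool.T? (Adj Γ (x ‼ toℕ i) (x ‼ suc (toℕ i))))

    closedᶠ⇒closed : ∀ x → IsClosedWalkᶠ x → IsClosedWalk x
    closedᶠ⇒closed x c a =
      subst₂ _~_ (‼-cong x (mod-≈ a)) (‼-cong x (≈-+ (≈-refl {1}) (mod-≈ a))) (c (a mod N))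

    closedWalk : Vec (Fin n) N → ℕ
    closedWalk x = 𝟙 (isClosedWalkᶠ? x)

    closedWalk-cong : ∀ x y → (IsClosedWalk x → IsClosedWalk y) → (IsClosedWalk y → IsClosedWalk x) →
                      closedWalk x ≡ closedWalk y
    closedWalk-cong x y x⇒y y⇒x = 𝟙-cong (isClosedWalkᶠ? x) (isClosedWalkᶠ? y)
      (λ c i → x⇒y (closedᶠ⇒closed x c) (toℕ i)) (λ c i → y⇒x (closedᶠ⇒closed y c) (toℕ i))

    ‼-suc≡next : (y : Vec (Fin n) N) (p : Fin N) → y ‼ suc (toℕ p) ≡ next y (Vec.head y) p
    ‼-suc≡next y p with lastView p
    ... | inj₁ (q , refl) = trans (cong (Vec.lookup y) (≈⇒mod≡ _ (Fin.suc q) (≡⇒≈ (cong suc (Finₚ.toℕ-inject₁ q)))))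
                                  (sym (next-inject₁ y (Vec.head y) q))
    ... | inj₂ refl = trans (‼-cong y (≈-intro (suc (toℕ (fromℕ h))) 0 0 1 (cong (λ z → suc z + 0) (Finₚ.toℕ-fromℕ h))))
                            (trans (head≡ y) (sym (next-last y (Vec.head y))))
      where
      head≡ : (y : Vec (Fin n) N) → y ‼ 0 ≡ Vec.head y
      head≡ (a Vec.∷ _) = refl

    closedWalk≡walkWeight : (y : Vec (Fin n) N) → closedWalk y ≡ walkWeight (Vec.head y) (Vec.tail y) (Vec.head y)
    closedWalk≡walkWeight (a Vec.∷ u) = trans
      (𝟙-cong (isClosedWalkᶠ? (a Vec.∷ u)) (isWalk? a u a)
        (λ c → steps⇒isWalk a u a (λ p → subst₂ _~_ (‼-toℕ (a Vec.∷ u) p) (‼-suc≡next (a Vec.∷ u) p) (c p)))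
        (λ w p → subst₂ _~_ (sym (‼-toℕ (a Vec.∷ u) p)) (sym (‼-suc≡next (a Vec.∷ u) p)) (isWalk⇒steps a u a w p)))
      (sym (walkWeight≡𝟙 a u a))

    ∑-closedWalk≡trace : ∑[ x ∈ words N ] closedWalk x ≡ trace (A ^ᴹ N)
    ∑-closedWalk≡trace = begin
      ∑[ x ∈ words N ] closedWalk x
        ≡⟨ ∑-vectors (allFin n) h closedWalk ⟩
      ∑[ a ∈ allFin n ] ∑[ u ∈ words h ] closedWalk (a Vec.∷ u)
        ≡⟨ ∑-cong (allFin n) (λ a → ∑-cong (words h) (λ u → closedWalk≡walkWeight (a Vec.∷ u))) ⟩
      ∑[ a ∈ allFin n ] ∑[ u ∈ words h ] walkWeight a u a
        ≡⟨ ∑-cong (allFin n) (λ a → sym (^ᴹ-suc≡∑-walks h a a)) ⟩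
      trace (A ^ᴹ N) ∎
      where open ≡-Reasoning

module ClosedWalkAction {n : ℕ} (Γ : SimpleGraph n) (P : ℕ) where

  open Modular P
  open Dihedral P
  open Action {Fin n}
  open Walks Γ
  open ClosedWalks P public
  open Vectors (Finₚ._≟_ {n}) using (_≟ᵛ_)

  act-preserves-closed : ∀ g x → IsClosedWalk x → IsClosedWalk (act g x)
  act-preserves-closed (false , k) x closed a = subst₂ _~_
    (sym (‼-act (false , k) x a))
    (trans (‼-cong x (≡⇒≈ (ring (toℕ k) a))) (sym (‼-act (false , k) x (suc a))))
    (closed (toℕ k + 1 * a))
    where
    ring : ∀ K a → suc (K + 1 * a) ≡ K + 1 * suc a
    ring = solve-∀
  act-preserves-closed (true , k) x closed a = subst₂ _~_
    (trans (‼-cong x (≡+*N⇒≈ _ _ 1 (ring (toℕ k) a P))) (sym (‼-act (true , k) x a)))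
    (sym (‼-act (true , k) x (suc a)))
    (~-sym (closed (toℕ k + P * suc a)))
    where
    ring : ∀ K a p → suc (K + p * suc a) ≡ K + p * a + 1 * suc p
    ring = solve-∀

  closedWalk-invariant : ∀ g x → closedWalk (act g x) ≡ closedWalk x
  closedWalk-invariant g x = closedWalk-cong (act g x) x
    (λ c → subst IsClosedWalk (GroupAction.act-inverseˡ dihedralAction g x) (act-preserves-closed (inv g) (act g x) c))
    (act-preserves-closed g x)

  fixedClosedWalks : D → ℕ
  fixedClosedWalks g = ∑[ x ∈ words N ] (closedWalk x * 𝟙 (act g x ≟ᵛ x))

  2N∣∑-fixedClosedWalks :
    2 * N ∣ ∑[ k ∈ allFin N ] fixedClosedWalks (false , k) + ∑[ k ∈ allFin N ] fixedClosedWalks (true , k)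
  2N∣∑-fixedClosedWalks = divides weightedOrbitCount (begin
    ∑[ k ∈ allFin N ] fixedClosedWalks (false , k) + ∑[ k ∈ allFin N ] fixedClosedWalks (true , k)
      ≡⟨ ∑-elements fixedClosedWalks ⟨
    ∑ elements fixedClosedWalks
      ≡⟨ burnside ⟩
    length elements * weightedOrbitCount
      ≡⟨ cong (_* weightedOrbitCount) length-elements ⟩
    2 * N * weightedOrbitCount
      ≡⟨ *-comm (2 * N) weightedOrbitCount ⟩
    weightedOrbitCount * (2 * N) ∎)
    where
    open ≡-Reasoning
    open Burnside _≟D_ _≟ᵛ_ elements (words N) enumerates-elements (enumerates-words N)
                  dihedralAction encode encode-injective closedWalk closedWalk-invariant

module RotationFixedPoints {n : ℕ} (Γ : SimpleGraph n) (P : ℕ) where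

  open ClosedWalkAction Γ P
  open Modular P
  open Dihedral P
  open Action {Fin n}
  open Walks Γ using (words; enumerates-words; _~_)
  open Vectors (Finₚ._≟_ {n}) using (_≟ᵛ_)

  Periodic : ℕ → Vec (Fin n) N → Set
  Periodic p x = ∀ a → x ‼ (p + a) ≡ x ‼ a

  periodic-* : ∀ {p} (x : Vec (Fin n) N) → Periodic p x → ∀ s a → x ‼ (s * p + a) ≡ x ‼ a
  periodic-* x per zero    a = refl
  periodic-* {p} x per (suc s) a = trans (cong (x ‼_) (+-assoc p (s * p) a)) (trans (per (s * p + a)) (periodic-* x per s a))

  ‼-+*N : ∀ (x : Vec (Fin n) N) t a → x ‼ (t * N + a) ≡ x ‼ a
  ‼-+*N x t a = ‼-cong x (≈-intro (t * N + a) a 0 t (trans (+-identityʳ _) (+-comm (t * N) a)))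

  fixed⇒periodic : ∀ k (x : Vec (Fin n) N) → act (false , k) x ≡ x → Periodic (toℕ k) x
  fixed⇒periodic k x fixed a = begin
    x ‼ (toℕ k + a)                 ≡⟨ cong (λ b → x ‼ (toℕ k + b)) (*-identityˡ a) ⟨
    x ‼ ⟦ false , k ⟧ a             ≡⟨ ‼-act (false , k) x a ⟨
    act (false , k) x ‼ a           ≡⟨ cong (_‼ a) fixed ⟩
    x ‼ a                           ∎
    where open ≡-Reasoning

  periodic-gcd : ∀ {g K} (x : Vec (Fin n) N) → Bézout.Identity g K N → Periodic K x → Periodic g x
  periodic-gcd {g} {K} x (Bézout.+- s t eq) per a = begin
    x ‼ (g + a)              ≡⟨ ‼-+*N x t (g + a) ⟨
    x ‼ (t * N + (g + a))    ≡⟨ cong (x ‼_) (trans (ring (t * N) g a) (cong (_+ a) eq)) ⟩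
    x ‼ (s * K + a)          ≡⟨ periodic-* x per s a ⟩
    x ‼ a                    ∎
    where
    open ≡-Reasoning
    ring : ∀ u v a → u + (v + a) ≡ v + u + a
    ring = solve-∀
  periodic-gcd {g} {K} x (Bézout.-+ s t eq) per a = begin
    x ‼ (g + a)              ≡⟨ periodic-* x per s (g + a) ⟨
    x ‼ (s * K + (g + a))    ≡⟨ cong (x ‼_) (trans (ring (s * K) g a) (cong (_+ a) eq)) ⟩
    x ‼ (t * N + a)          ≡⟨ ‼-+*N x t a ⟩
    x ‼ a                    ∎
    where
    open ≡-Reasoning
    ring : ∀ u v a → u + (v + a) ≡ v + u + a
    ring = solve-∀

  module _ (k : Fin N) (h : ℕ) (g∣k : suc h ∣ toℕ k) (g∣N : suc h ∣ N) (bézout : Bézout.Identity (suc h) (toℕ k) N) where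

    private
      g = suc h
      module G = Modular h
      module ClosedG = Walks.ClosedWalks Γ h

    periodic-% : ∀ (x : Vec (Fin n) N) → Periodic g x → ∀ b → x ‼ (b % g) ≡ x ‼ b
    periodic-% x per b = trans (sym (periodic-* x per (b / g) (b % g)))
      (cong (x ‼_) (trans (+-comm (b / g * g) (b % g)) (sym (m≡m%n+[m/n]*n b g))))

    unroll : Vec (Fin n) g → Vec (Fin n) N
    unroll y = tabulateℕ (λ a → y G.‼ a)

    ‼-unroll : ∀ y b → unroll y ‼ b ≡ y G.‼ b
    ‼-unroll y b = trans (‼-tabulateℕ (λ a → y G.‼ a) b) (G.‼-cong y (G.mk≈ {b % N} {b} (m∣n⇒o%n%m≡o%m g N b g∣N)))

    period : Vec (Fin n) N → Vec (Fin n) g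
    period x = G.tabulateℕ (λ a → x ‼ a)

    period-unroll : ∀ y → period (unroll y) ≡ y
    period-unroll y = G.‼-ext _ _ (λ a →
      trans (G.‼-tabulateℕ (λ a → unroll y ‼ a) a) (trans (‼-unroll y (a % g)) (G.‼-cong y (G.%-≈ a))))

    unroll-fixed : ∀ y → act (false , k) (unroll y) ≡ unroll y
    unroll-fixed y = ‼-ext _ _ (λ a → begin
      act (false , k) (unroll y) ‼ a     ≡⟨ ‼-act (false , k) (unroll y) a ⟩
      unroll y ‼ (toℕ k + 1 * a)         ≡⟨ ‼-unroll y (toℕ k + 1 * a) ⟩
      y G.‼ (toℕ k + 1 * a)              ≡⟨ G.‼-cong y (shift g∣k) ⟩
      y G.‼ a                            ≡⟨ ‼-unroll y a ⟨
      unroll y ‼ a                       ∎)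
      where
      open ≡-Reasoning
      shift : ∀ {a} → g ∣ toℕ k → toℕ k + 1 * a G.≈ a
      shift {a} (divides q eq) = G.≈-intro _ a 0 q (trans (cong (λ z → z + 1 * a + 0 * g) eq) (ring q g a))
        where
        ring : ∀ q g a → q * g + 1 * a + 0 * g ≡ a + q * g
        ring = solve-∀

    unroll-period : ∀ (x : Vec (Fin n) N) → act (false , k) x ≡ x → unroll (period x) ≡ x
    unroll-period x fixed = ‼-ext _ _ (λ b →
      trans (‼-unroll (period x) b)
            (trans (G.‼-tabulateℕ (λ a → x ‼ a) b)
                   (periodic-% x (periodic-gcd x bézout (fixed⇒periodic k x fixed)) b)))

    closedWalk-unroll : ∀ y → closedWalk (unroll y) ≡ ClosedG.closedWalk y
    closedWalk-unroll y = 𝟙-cong (isClosedWalkᶠ? (unroll y)) (ClosedG.isClosedWalkᶠ? y)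
      (λ c i → subst₂ _~_ (‼-unroll y (toℕ i)) (‼-unroll y (suc (toℕ i))) (closedᶠ⇒closed (unroll y) c (toℕ i)))
      (λ c i → subst₂ _~_ (sym (‼-unroll y (toℕ i))) (sym (‼-unroll y (suc (toℕ i)))) (ClosedG.closedᶠ⇒closed y c (toℕ i)))

    fixed-rotation≡trace′ : fixedClosedWalks (false , k) ≡ trace (adjMatrix Γ ^ᴹ g)
    fixed-rotation≡trace′ = begin
      ∑[ x ∈ words N ] (closedWalk x * 𝟙 (act (false , k) x ≟ᵛ x))
        ≡⟨ ∑-cong (words N) (λ x → *-comm (closedWalk x) _) ⟩
      ∑[ x ∈ words N ] (𝟙 (act (false , k) x ≟ᵛ x) * closedWalk x)
        ≡⟨ Reindex.∑-reindex-onto _≟ᵛ_ _≟ᵛ_ (words N) (words g) (enumerates-words N) (enumerates-words g)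
             (λ x → act (false , k) x ≟ᵛ x) unroll period unroll-fixed period-unroll unroll-period closedWalk ⟩
      ∑[ y ∈ words g ] closedWalk (unroll y)
        ≡⟨ ∑-cong (words g) closedWalk-unroll ⟩
      ∑[ y ∈ words g ] ClosedG.closedWalk y
        ≡⟨ ClosedG.∑-closedWalk≡trace ⟩
      trace (adjMatrix Γ ^ᴹ g) ∎
      where open ≡-Reasoning

  fixed-rotation≡trace : ∀ (k : Fin N) → fixedClosedWalks (false , k) ≡ trace (adjMatrix Γ ^ᴹ gcd (toℕ k) N)
  fixed-rotation≡trace k with gcd (toℕ k) N | gcd[m,n]∣m (toℕ k) N | gcd[m,n]∣n (toℕ k) N | Bézout.identity (gcd-GCD (toℕ k) N)
  ... | zero  | _   | divides q eq | _      = ⊥-elim (0≢1+n (sym (trans eq (*-zeroʳ q))))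
  ... | suc h | g∣k | g∣N          | bézout = fixed-rotation≡trace′ k h g∣k g∣N bézout

module ReflectionFixedPoints {n : ℕ} (Γ : SimpleGraph n) (P′ : ℕ) where

  P : ℕ
  P = suc P′

  open ClosedWalkAction Γ P
  open Modular P
  open Dihedral P
  open Action {Fin n}
  open Walks Γ using (words; enumerates-words; _~_; ~-irrefl)
  open Vectors (Finₚ._≟_ {n}) using (_≟ᵛ_)

  fixedReflection : ℕ → ℕ
  fixedReflection a = fixedClosedWalks (true , a mod N)

  FixedByReflection : ℕ → Vec (Fin n) N → Set
  FixedByReflection a x = ∀ j → x ‼ (a + P * j) ≡ x ‼ j

  fixed⇒fixedByReflection : ∀ a x → act (true , a mod N) x ≡ x → FixedByReflection a x
  fixed⇒fixedByReflection a x fixed j =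
    trans (‼-cong x (≈-+ (≈-sym (mod-≈ a)) (≈-refl {P * j})))
          (trans (sym (‼-act (true , a mod N) x j)) (cong (_‼ j) fixed))

  fixedByReflection⇒fixed : ∀ a x → FixedByReflection a x → act (true , a mod N) x ≡ x
  fixedByReflection⇒fixed a x fixed = ‼-ext _ _ (λ j →
    trans (‼-act (true , a mod N) x j) (trans (‼-cong x (≈-+ (mod-≈ a) (≈-refl {P * j}))) (fixed j)))

  rotate : ℕ → Vec (Fin n) N → Vec (Fin n) N
  rotate r = act (false , r mod N)

  ‼-rotate : ∀ r x j → rotate r x ‼ j ≡ x ‼ (r + j)
  ‼-rotate r x j = trans (‼-act (false , r mod N) x j) (‼-cong x (≈-+ (mod-≈ r) (≡⇒≈ (*-identityˡ j))))

  rotate-inverse : ∀ r s x → r + s ≡ N → rotate r (rotate s x) ≡ x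
  rotate-inverse r s x r+s≡N = ‼-ext _ _ (λ j → begin
    rotate r (rotate s x) ‼ j
      ≡⟨ ‼-rotate r (rotate s x) j ⟩
    rotate s x ‼ (r + j)
      ≡⟨ ‼-rotate s x (r + j) ⟩
    x ‼ (s + (r + j))
      ≡⟨ ‼-cong x (≡+*N⇒≈ _ j 1 (trans (ring s r j) (cong (j +_) (trans r+s≡N (sym (+-identityʳ N)))))) ⟩
    x ‼ j ∎)
    where
    open ≡-Reasoning
    ring : ∀ s r j → s + (r + j) ≡ j + (r + s)
    ring = solve-∀

  -- Conjugating by a one-step rotation moves the axis of a reflection by two steps.
  rotate-fixedByReflection : ∀ a y → FixedByReflection a y → FixedByReflection (2 + a) (rotate P y)
  rotate-fixedByReflection a y fixed j = begin
    rotate P y ‼ (2 + a + P * j)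
      ≡⟨ ‼-rotate P y (2 + a + P * j) ⟩
    y ‼ (P + (2 + a + P * j))                 ≡⟨ fixed (P + (2 + a + P * j)) ⟨
    y ‼ (a + P * (P + (2 + a + P * j)))
      ≡⟨ ‼-cong y (≈-intro (a + P * (P + (2 + a + P * j))) (P + j) 0 (a + P + j * P′) (ring a j P′)) ⟩
    y ‼ (P + j)                               ≡⟨ ‼-rotate P y j ⟨
    rotate P y ‼ j ∎
    where
    open ≡-Reasoning
    ring : ∀ a j q → a + suc q * (suc q + (2 + a + suc q * j)) + 0 * suc (suc q) ≡ suc q + j + (a + suc q + j * q) * suc (suc q)
    ring = solve-∀

  unrotate-fixedByReflection : ∀ a x → FixedByReflection (2 + a) x → FixedByReflection a (rotate 1 x)
  unrotate-fixedByReflection a x fixed j = begin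
    rotate 1 x ‼ (a + P * j)
      ≡⟨ ‼-rotate 1 x (a + P * j) ⟩
    x ‼ (1 + (a + P * j))
      ≡⟨ ‼-cong x (≈-intro (1 + (a + P * j)) (2 + a + P * (1 + j)) 1 0 (ring a j P)) ⟩
    x ‼ (2 + a + P * (1 + j))
      ≡⟨ fixed (1 + j) ⟩
    x ‼ (1 + j)                       ≡⟨ ‼-rotate 1 x j ⟨
    rotate 1 x ‼ j ∎
    where
    open ≡-Reasoning
    ring : ∀ a j p → 1 + (a + p * j) + 1 * suc p ≡ 2 + a + p * (1 + j) + 0 * suc p
    ring = solve-∀

  fixedReflection-2-periodic : ∀ a → fixedReflection (2 + a) ≡ fixedReflection a
  fixedReflection-2-periodic a = begin
    ∑[ x ∈ words N ] (closedWalk x * 𝟙 (act (true , (2 + a) mod N) x ≟ᵛ x))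
      ≡⟨ ∑-cong (words N) (λ x → *-comm (closedWalk x) _) ⟩
    ∑[ x ∈ words N ] (𝟙 (act (true , (2 + a) mod N) x ≟ᵛ x) * closedWalk x)
      ≡⟨ Reindex.∑-reindex _≟ᵛ_ _≟ᵛ_ (words N) (words N) (enumerates-words N) (enumerates-words N)
           (λ x → act (true , (2 + a) mod N) x ≟ᵛ x) (λ y → act (true , a mod N) y ≟ᵛ y)
           (rotate P) (rotate 1)
           (λ y fixed → fixedByReflection⇒fixed (2 + a) (rotate P y) (rotate-fixedByReflection a y (fixed⇒fixedByReflection a y fixed)))
           (λ y _ → rotate-inverse 1 P y refl)
           (λ x fixed → fixedByReflection⇒fixed a (rotate 1 x) (unrotate-fixedByReflection a x (fixed⇒fixedByReflection (2 + a) x fixed)))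
           (λ x _ → rotate-inverse P 1 x (+-comm P 1))
           closedWalk ⟩
    ∑[ y ∈ words N ] (𝟙 (act (true , a mod N) y ≟ᵛ y) * closedWalk (rotate P y))
      ≡⟨ ∑-cong (words N) (λ y → trans (cong (𝟙 (act (true , a mod N) y ≟ᵛ y) *_) (closedWalk-invariant (false , P mod N) y))
                                          (*-comm _ (closedWalk y))) ⟩
    ∑[ y ∈ words N ] (closedWalk y * 𝟙 (act (true , a mod N) y ≟ᵛ y)) ∎
    where open ≡-Reasoning

  -- A closed walk fixed by i ↦ 1 − i has x₀ = x₁, i.e. a loop.
  fixedReflection-1≡0 : fixedReflection 1 ≡ 0
  fixedReflection-1≡0 = ∑-zero (words N) _ (λ x → no-loop x (isClosedWalkᶠ? x) (act (true , 1 mod N) x ≟ᵛ x))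
    where
    no-loop : ∀ x (c : Dec (IsClosedWalkᶠ x)) (d : Dec (act (true , 1 mod N) x ≡ x)) → 𝟙 c * 𝟙 d ≡ 0
    no-loop x (yes c) (yes fixed) = ⊥-elim (~-irrefl (subst (_~ x ‼ 1) x₀≡x₁ (closedᶠ⇒closed x c 0)))
      where
      x₀≡x₁ : x ‼ 0 ≡ x ‼ 1
      x₀≡x₁ = trans (‼-cong x (≈-intro 0 (1 + P * 1) 1 0 (ring P′))) (fixed⇒fixedByReflection 1 x fixed 1)
        where
        ring : ∀ q → 0 + 1 * suc (suc q) ≡ 1 + suc q * 1 + 0 * suc (suc q)
        ring = solve-∀
    no-loop x (yes _) (no _) = refl
    no-loop x (no _)  _      = refl

  ∑-fixedReflection : ∀ M → N ≡ M + M → ∑[ k ∈ allFin N ] fixedClosedWalks (true , k) ≡ M * fixedReflection 0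
  ∑-fixedReflection M N≡2M = begin
    ∑[ k ∈ allFin N ] fixedClosedWalks (true , k)
      ≡⟨ ∑-cong (allFin N) (λ k → cong (λ k′ → fixedClosedWalks (true , k′)) (sym (toℕ-mod-N k))) ⟩
    ∑[ k ∈ allFin N ] fixedReflection (toℕ k)
      ≡⟨ cong (λ m → ∑[ k ∈ allFin m ] fixedReflection (toℕ k)) N≡2M ⟩
    ∑[ k ∈ allFin (M + M) ] fixedReflection (toℕ k)
      ≡⟨ ∑-allFin-2-periodic M fixedReflection fixedReflection-2-periodic ⟩
    M * (fixedReflection 0 + fixedReflection 1)
      ≡⟨ cong (λ z → M * (fixedReflection 0 + z)) fixedReflection-1≡0 ⟩
    M * (fixedReflection 0 + 0)
      ≡⟨ cong (M *_) (+-identityʳ _) ⟩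
    M * fixedReflection 0 ∎
    where open ≡-Reasoning

φ≡∑ : ∀ M → φ M ≡ ∑[ i ∈ allFin M ] 𝟙 (gcd (suc (toℕ i)) M ≟ 1)
φ≡∑ M = trans (length-filter (λ k → gcd k M ≟ 1) (applyUpTo suc M)) (∑-applyUpTo suc M _)

gcd[n,n]≡n : ∀ n → gcd n n ≡ n
gcd[n,n]≡n n = ∣-antisym (gcd[m,n]∣m n n) (gcd-greatest ∣-refl ∣-refl)

-- Indices are shifted by one: j : Fin P stands for j + 1 ∈ {1, …, N − 1}.
module GcdCount (P′ d : ℕ) (0<d : 0 < d) (d≤P : d ≤ suc P′) where

  P N : ℕ
  P = suc P′
  N = suc P

  instance
    d-nonZero : NonZero d
    d-nonZero = >-nonZero 0<d

  HasGcd : Fin P → Set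
  HasGcd j = gcd (suc (toℕ j)) N ≡ d

  hasGcd? : ∀ j → Dec (HasGcd j)
  hasGcd? j = gcd (suc (toℕ j)) N ≟ d

  count : ℕ
  count = ∑[ j ∈ allFin P ] 𝟙 (hasGcd? j)

  count-∤ : ¬ (d ∣ N) → count ≡ 0
  count-∤ d∤N = ∑-zero (allFin P) _ (λ j → 𝟙-no (hasGcd? j) (λ eq → d∤N (subst (_∣ N) eq (gcd[m,n]∣n (suc (toℕ j)) N))))

  module _ (M′ : ℕ) (N≡Md : N ≡ suc M′ * d) where

    M : ℕ
    M = suc M′

    Coprime : Fin M → Set
    Coprime i = gcd (suc (toℕ i)) M ≡ 1

    coprime? : ∀ i → Dec (Coprime i)
    coprime? i = gcd (suc (toℕ i)) M ≟ 1

    N≡dM : N ≡ d * M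
    N≡dM = trans N≡Md (*-comm M d)

    scale : Fin M → Fin P
    scale i = (d * suc (toℕ i) ∸ 1) mod P

    unscale : Fin P → Fin M
    unscale j = (suc (toℕ j) / d ∸ 1) mod M

    coprime⇒< : ∀ i → Coprime i → suc (toℕ i) < M
    coprime⇒< i coprime with m≤n⇒m<n∨m≡n (Finₚ.toℕ<n i)
    ... | inj₁ lt = lt
    ... | inj₂ eq = ⊥-elim (<-irrefl refl (<-≤-trans N≤d d≤P))
      where
      M≡1 : M ≡ 1
      M≡1 = trans (sym (gcd[n,n]≡n M)) (trans (cong (λ z → gcd z M) (sym eq)) coprime)
      N≤d : N ≤ d
      N≤d = ≤-reflexive (trans N≡dM (trans (cong (d *_) M≡1) (*-identityʳ d)))

    suc-toℕ-scale : ∀ i → Coprime i → suc (toℕ (scale i)) ≡ d * suc (toℕ i)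
    suc-toℕ-scale i coprime = trans (cong suc (trans (toℕ-mod (d * a ∸ 1) P) (m<n⇒m%n≡m lt))) (suc-pred (d * a))
      where
      a = suc (toℕ i)
      instance
        da-nonZero : NonZero (d * a)
        da-nonZero = m*n≢0 d a
      lt : d * a ∸ 1 < P
      lt = s≤s⁻¹ (subst (_< N) (sym (suc-pred (d * a)))
             (subst (d * a <_) (sym N≡dM) (*-monoʳ-< d (coprime⇒< i coprime))))

    scale-hasGcd : ∀ i → Coprime i → HasGcd (scale i)
    scale-hasGcd i coprime = begin
      gcd (suc (toℕ (scale i))) N     ≡⟨ cong₂ gcd (suc-toℕ-scale i coprime) N≡dM ⟩
      gcd (d * suc (toℕ i)) (d * M)  ≡⟨ c*gcd[m,n]≡gcd[cm,cn] d (suc (toℕ i)) M ⟨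
      d * gcd (suc (toℕ i)) M        ≡⟨ cong (d *_) coprime ⟩
      d * 1                          ≡⟨ *-identityʳ d ⟩
      d                              ∎
      where open ≡-Reasoning

    unscale-scale : ∀ i → Coprime i → unscale (scale i) ≡ i
    unscale-scale i coprime = Finₚ.toℕ-injective (begin
      toℕ (unscale (scale i))
        ≡⟨ toℕ-mod (suc (toℕ (scale i)) / d ∸ 1) M ⟩
      (suc (toℕ (scale i)) / d ∸ 1) % M
        ≡⟨ cong (λ z → (z / d ∸ 1) % M) (trans (suc-toℕ-scale i coprime) (*-comm d _)) ⟩
      (suc (toℕ i) * d / d ∸ 1) % M
        ≡⟨ cong (λ z → (z ∸ 1) % M) (m*n/n≡m (suc (toℕ i)) d) ⟩
      toℕ i % M
        ≡⟨ m<n⇒m%n≡m (Finₚ.toℕ<n i) ⟩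
      toℕ i ∎)
      where open ≡-Reasoning

    module _ (j : Fin P) (hasGcd : HasGcd j) where

      private
        d∣j : d ∣ suc (toℕ j)
        d∣j = subst (_∣ suc (toℕ j)) hasGcd (gcd[m,n]∣m (suc (toℕ j)) N)
        q = _∣_.quotient d∣j
        j≡qd : suc (toℕ j) ≡ q * d
        j≡qd = _∣_.equality d∣j

        0<q : 0 < q
        0<q with q | j≡qd
        ... | suc _ | _ = s≤s z≤n

        q<M : q < M
        q<M = *-cancelʳ-< d q M (subst₂ _<_ j≡qd N≡Md (s≤s (Finₚ.toℕ<n j)))

        suc-toℕ-unscale : suc (toℕ (unscale j)) ≡ q
        suc-toℕ-unscale = trans (cong suc (trans (toℕ-mod (suc (toℕ j) / d ∸ 1) M)
          (trans (cong (λ z → (z ∸ 1) % M) (trans (cong (_/ d) j≡qd) (m*n/n≡m q d)))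
                 (m<n⇒m%n≡m (≤-<-trans (m∸n≤m q 1) q<M)))))
          (suc-pred q {{>-nonZero 0<q}})

      unscale-coprime : Coprime (unscale j)
      unscale-coprime = *-cancelˡ-≡ (gcd (suc (toℕ (unscale j))) M) 1 d (begin
        d * gcd (suc (toℕ (unscale j))) M  ≡⟨ cong (λ z → d * gcd z M) suc-toℕ-unscale ⟩
        d * gcd q M                        ≡⟨ c*gcd[m,n]≡gcd[cm,cn] d q M ⟩
        gcd (d * q) (d * M)                ≡⟨ cong₂ gcd (trans (*-comm d q) (sym j≡qd)) (sym N≡dM) ⟩
        gcd (suc (toℕ j)) N                ≡⟨ hasGcd ⟩
        d                                  ≡⟨ *-identityʳ d ⟨
        d * 1                              ∎)
        where open ≡-Reasoning

      scale-unscale : scale (unscale j) ≡ j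
      scale-unscale = Finₚ.toℕ-injective (begin
        toℕ (scale (unscale j))
          ≡⟨ toℕ-mod (d * suc (toℕ (unscale j)) ∸ 1) P ⟩
        (d * suc (toℕ (unscale j)) ∸ 1) % P
          ≡⟨ cong (λ z → (d * z ∸ 1) % P) suc-toℕ-unscale ⟩
        (d * q ∸ 1) % P
          ≡⟨ cong (λ z → (z ∸ 1) % P) (trans (*-comm d q) (sym j≡qd)) ⟩
        toℕ j % P
          ≡⟨ m<n⇒m%n≡m (Finₚ.toℕ<n j) ⟩
        toℕ j ∎)
        where open ≡-Reasoning

    count-∣ : count ≡ φ M
    count-∣ = begin
      count
        ≡⟨ ∑-cong (allFin P) (λ j → *-identityʳ _) ⟨
      ∑[ j ∈ allFin P ] (𝟙 (hasGcd? j) * 1)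
        ≡⟨ Reindex.∑-reindex Finₚ._≟_ Finₚ._≟_ (allFin P) (allFin M) (enumerates-allFin P) (enumerates-allFin M)
             hasGcd? coprime? scale unscale scale-hasGcd unscale-scale unscale-coprime scale-unscale (λ _ → 1) ⟩
      ∑[ i ∈ allFin M ] (𝟙 (coprime? i) * 1)
        ≡⟨ ∑-cong (allFin M) (λ i → *-identityʳ _) ⟩
      ∑[ i ∈ allFin M ] 𝟙 (coprime? i)
        ≡⟨ φ≡∑ M ⟨
      φ M ∎
      where open ≡-Reasoning

  count≡φ : count ≡ 𝟙 (d ∣? N) * φ (N / d)
  count≡φ with d ∣? N
  ... | no d∤N = count-∤ d∤N
  ... | yes (divides (suc M′) N≡Md) =
    trans (count-∣ M′ N≡Md) (trans (cong φ (sym (trans (cong (_/ d) N≡Md) (m*n/n≡m (suc M′) d)))) (sym (+-identityʳ _)))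

∑-allFin-select : ∀ P (T : ℕ → ℕ) {c} → 0 < c → c ≤ P →
                  T c ≡ ∑[ i ∈ allFin P ] (𝟙 (c ≟ suc (toℕ i)) * T (suc (toℕ i)))
∑-allFin-select P T {suc c′} _ c′<P = sym (trans
  (∑-cong (allFin P) (λ i → cong (_* T (suc (toℕ i))) (𝟙-cong (suc c′ ≟ suc (toℕ i)) (i Finₚ.≟ c) toℕ⇒≡ ≡⇒toℕ)))
  (trans (Enumeration.∑-δ Finₚ._≟_ (allFin P) (enumerates-allFin P) c (λ i → T (suc (toℕ i))))
         (cong (λ z → T (suc z)) (Finₚ.toℕ-fromℕ< c′<P))))
  where
  c : Fin P
  c = fromℕ< c′<P
  toℕ⇒≡ : ∀ {i} → suc c′ ≡ suc (toℕ i) → i ≡ c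
  toℕ⇒≡ eq = Finₚ.toℕ-injective (trans (sym (suc-injective eq)) (sym (Finₚ.toℕ-fromℕ< c′<P)))
  ≡⇒toℕ : ∀ {i} → i ≡ c → suc c′ ≡ suc (toℕ i)
  ≡⇒toℕ refl = cong suc (sym (Finₚ.toℕ-fromℕ< c′<P))

∑-gcd≡properDivisorSum : ∀ P′ (T : ℕ → ℕ) →
  ∑[ k ∈ allFin (suc (suc P′)) ] T (gcd (toℕ k) (suc (suc P′))) ≡
  T (suc (suc P′)) + properDivisorSum (suc (suc P′)) (λ d N/d → φ N/d * T d)
∑-gcd≡properDivisorSum P′ T = begin
  ∑[ k ∈ allFin N ] T (gcd (toℕ k) N)
    ≡⟨ ∑-allFin-suc {P} (λ k → T (gcd (toℕ k) N)) ⟩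
  T (gcd 0 N) + ∑[ j ∈ allFin P ] T (gcd (suc (toℕ j)) N)
    ≡⟨ cong₂ _+_ (cong T (gcd-identityˡ N)) (∑-cong (allFin P) by-gcd) ⟩
  T N + ∑[ j ∈ allFin P ] ∑[ i ∈ allFin P ] (𝟙 (gcd (suc (toℕ j)) N ≟ suc (toℕ i)) * T (suc (toℕ i)))
    ≡⟨ cong (T N +_) (∑-comm (allFin P) (allFin P) _) ⟩
  T N + ∑[ i ∈ allFin P ] ∑[ j ∈ allFin P ] (𝟙 (gcd (suc (toℕ j)) N ≟ suc (toℕ i)) * T (suc (toℕ i)))
    ≡⟨ cong (T N +_) (∑-cong (allFin P) (λ i → ∑-*ʳ (allFin P) (T (suc (toℕ i))) (λ j → 𝟙 (gcd (suc (toℕ j)) N ≟ suc (toℕ i))))) ⟩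
  T N + ∑[ i ∈ allFin P ] (GcdCount.count P′ (suc (toℕ i)) (s≤s z≤n) (Finₚ.toℕ<n i) * T (suc (toℕ i)))
    ≡⟨ cong (T N +_) (∑-cong (allFin P) (λ i → trans
         (cong (_* T (suc (toℕ i))) (GcdCount.count≡φ P′ (suc (toℕ i)) (s≤s z≤n) (Finₚ.toℕ<n i)))
         (*-assoc (𝟙 (suc (toℕ i) ∣? N)) _ _))) ⟩
  T N + ∑[ i ∈ allFin P ] (𝟙 (suc (toℕ i) ∣? N) * (φ (N / suc (toℕ i)) * T (suc (toℕ i))))
    ≡⟨ cong (T N +_) (sym (trans (∑-filter (λ k → suc k ∣? N) (applyUpTo (λ k → k) P) _) (∑-applyUpTo (λ k → k) P _))) ⟩
  T N + properDivisorSum N (λ d N/d → φ N/d * T d) ∎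
  where
  open ≡-Reasoning
  P = suc P′
  N = suc P
  by-gcd : ∀ j → T (gcd (suc (toℕ j)) N) ≡ ∑[ i ∈ allFin P ] (𝟙 (gcd (suc (toℕ j)) N ≟ suc (toℕ i)) * T (suc (toℕ i)))
  by-gcd j = ∑-allFin-select P T
    (n≢0⇒n>0 (gcd[m,n]≢0 (suc (toℕ j)) N (inj₁ λ ())))
    (≤-trans (∣⇒≤ (gcd[m,n]∣m (suc (toℕ j)) N)) (Finₚ.toℕ<n j))

module Palindromes {n : ℕ} (Γ : SimpleGraph n) (M₁ : ℕ) where

  M : ℕ
  M = suc (suc M₁)

  open ReflectionFixedPoints Γ (M₁ + M)
  open ClosedWalkAction Γ P
  open Modular P
  open Dihedral P
  open Action {Fin n}
  open Walks Γ
  open Vectors (Finₚ._≟_ {n}) using (_≟ᵛ_)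
  module H = Modular M

  M<N : M < N
  M<N = m<m+n M {M} z<s

  N∸M≡M : N ∸ M ≡ M
  N∸M≡M = m+n∸n≡m M M

  N∸r≤M : ∀ {r} → M ≤ r → N ∸ r ≤ M
  N∸r≤M {r} M≤r = subst (N ∸ r ≤_) N∸M≡M (∸-monoʳ-≤ N M≤r)

  N∸r≈P*r : ∀ r → r ≤ N → N ∸ r ≈ P * r
  N∸r≈P*r r r≤N = ≈-sym (≈-intro (P * r) (N ∸ r) 1 r
    (trans (cong (P * r +_) (trans (*-identityˡ N) (sym (m∸n+n≡m r≤N)))) (ring P (N ∸ r) r)))
    where
    ring : ∀ p s r → p * r + (s + r) ≡ s + r * suc p
    ring = solve-∀

  -- Folds ℤ/N onto {0, …, M}, identifying i with −i.
  fold : ℕ → ℕ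
  fold r = r ⊓ (N ∸ r)

  fold-≤ : ∀ {r} → r ≤ M → fold r ≡ r
  fold-≤ {r} r≤M = m≤n⇒m⊓n≡m (≤-trans r≤M (subst (_≤ N ∸ r) N∸M≡M (∸-monoʳ-≤ N r≤M)))

  fold-≥ : ∀ {r} → M ≤ r → fold r ≡ N ∸ r
  fold-≥ M≤r = m≥n⇒m⊓n≡n (≤-trans (N∸r≤M M≤r) M≤r)

  fold-≤M : ∀ r → fold r ≤ M
  fold-≤M r with ≤-total r M
  ... | inj₁ r≤M = ≤-trans (m⊓n≤m r (N ∸ r)) r≤M
  ... | inj₂ M≤r = ≤-trans (m⊓n≤n r (N ∸ r)) (N∸r≤M M≤r)

  fold-N∸ : ∀ {r} → r ≤ N → fold (N ∸ r) ≡ fold r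
  fold-N∸ {r} r≤N = trans (cong ((N ∸ r) ⊓_) (m∸[m∸n]≡n r≤N)) (⊓-comm (N ∸ r) r)

  fold-P* : ∀ r → r < N → fold ((P * r) % N) ≡ fold r
  fold-P* zero       _   = cong (λ u → fold (u % N)) (*-zeroʳ P)
  fold-P* r@(suc _) r<N = trans (cong fold P*r%N≡N∸r) (fold-N∸ (<⇒≤ r<N))
    where
    P*r%N≡N∸r : (P * r) % N ≡ N ∸ r
    P*r%N≡N∸r = trans (sym (get (N∸r≈P*r r (<⇒≤ r<N)))) (m<n⇒m%n≡m (∸-monoʳ-< z<s (<⇒≤ r<N)))

  unfold : Vec (Fin n) (suc M) → Vec (Fin n) N
  unfold z = tabulateℕ (λ j → z H.‼ fold j)

  ‼-unfold : ∀ z j → unfold z ‼ j ≡ z H.‼ fold (j % N)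
  ‼-unfold z = ‼-tabulateℕ (λ j → z H.‼ fold j)

  ‼-unfold-≤ : ∀ z t → t ≤ M → unfold z ‼ t ≡ z H.‼ t
  ‼-unfold-≤ z t t≤M =
    trans (‼-unfold z t) (trans (cong (λ u → z H.‼ fold u) (m<n⇒m%n≡m (≤-<-trans t≤M M<N))) (cong (z H.‼_) (fold-≤ t≤M)))

  half : Vec (Fin n) N → Vec (Fin n) (suc M)
  half x = H.tabulateℕ (λ t → x ‼ t)

  half-unfold : ∀ z → half (unfold z) ≡ z
  half-unfold z = H.‼-ext _ _ (λ t → begin
    half (unfold z) H.‼ t    ≡⟨ H.‼-tabulateℕ (λ t → unfold z ‼ t) t ⟩
    unfold z ‼ (t % suc M)   ≡⟨ ‼-unfold-≤ z (t % suc M) (s≤s⁻¹ (m%n<n t (suc M))) ⟩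
    z H.‼ (t % suc M)        ≡⟨ H.‼-cong z (H.%-≈ t) ⟩
    z H.‼ t                  ∎)
    where open ≡-Reasoning

  unfold-half : ∀ x → act (true , 0 mod N) x ≡ x → unfold (half x) ≡ x
  unfold-half x fixed = ‼-ext _ _ (λ j → begin
    unfold (half x) ‼ j      ≡⟨ ‼-unfold (half x) j ⟩
    half x H.‼ fold (j % N)  ≡⟨ H.‼-tabulateℕ (λ t → x ‼ t) (fold (j % N)) ⟩
    x ‼ (fold (j % N) % suc M) ≡⟨ cong (x ‼_) (m<n⇒m%n≡m (s≤s (fold-≤M (j % N)))) ⟩
    x ‼ fold (j % N)         ≡⟨ ‼-fold (j % N) (m%n<n j N) ⟩
    x ‼ (j % N)              ≡⟨ ‼-cong x (%-≈ j) ⟩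
    x ‼ j                    ∎)
    where
    open ≡-Reasoning
    ‼-fold : ∀ r → r < N → x ‼ fold r ≡ x ‼ r
    ‼-fold r r<N with ≤-total r M
    ... | inj₁ r≤M = cong (x ‼_) (fold-≤ r≤M)
    ... | inj₂ M≤r = trans (cong (x ‼_) (fold-≥ M≤r))
                           (trans (‼-cong x (N∸r≈P*r r (<⇒≤ r<N))) (fixed⇒fixedByReflection 0 x fixed r))

  unfold-fixed : ∀ z → act (true , 0 mod N) (unfold z) ≡ unfold z
  unfold-fixed z = fixedByReflection⇒fixed 0 (unfold z) (λ j → begin
    unfold z ‼ (P * j)                ≡⟨ ‼-unfold z (P * j) ⟩
    z H.‼ fold ((P * j) % N)          ≡⟨ cong (λ u → z H.‼ fold u) (get (≈-* (≈-refl {P}) (≈-sym (%-≈ j)))) ⟩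
    z H.‼ fold ((P * (j % N)) % N)    ≡⟨ cong (z H.‼_) (fold-P* (j % N) (m%n<n j N)) ⟩
    z H.‼ fold (j % N)                ≡⟨ ‼-unfold z j ⟨
    unfold z ‼ j                      ∎)
    where open ≡-Reasoning

  IsHalfPath : Vec (Fin n) (suc M) → Set
  IsHalfPath z = ∀ t → t < M → z H.‼ t ~ z H.‼ suc t

  closed⇒halfPath : ∀ z → IsClosedWalk (unfold z) → IsHalfPath z
  closed⇒halfPath z closed t t<M = subst₂ _~_ (‼-unfold-≤ z t (<⇒≤ t<M)) (‼-unfold-≤ z (suc t) t<M) (closed t)

  halfPath⇒closed : ∀ z → IsHalfPath z → IsClosedWalk (unfold z)
  halfPath⇒closed z path a = subst₂ _~_
    (sym (‼-unfold z a))
    (trans (cong (λ u → z H.‼ fold u) (sym suc-a%N)) (sym (‼-unfold z (suc a))))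
    (step (a % N) (m%n<n a N))
    where
    suc-a%N : suc a % N ≡ suc (a % N) % N
    suc-a%N = get (≈-+ (≈-refl {1}) (≈-sym (%-≈ a)))
    step : ∀ r → r < N → z H.‼ fold r ~ z H.‼ fold (suc r % N)
    step r r<N with r <? M
    ... | yes r<M = subst₂ _~_
      (cong (z H.‼_) (sym (fold-≤ (<⇒≤ r<M))))
      (cong (z H.‼_) (sym (trans (cong fold (m<n⇒m%n≡m (≤-<-trans r<M M<N))) (fold-≤ r<M))))
      (path r r<M)
    ... | no r≮M = subst₂ _~_ (cong (z H.‼_) suc-t≡fold-r) (cong (z H.‼_) (sym fold-suc-r≡t)) (~-sym (path t t<M))
      where
      M≤r = ≮⇒≥ r≮M
      t = N ∸ suc r
      suc-t : suc t ≡ N ∸ r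
      suc-t = sym (+-∸-assoc 1 r<N)
      t<M : t < M
      t<M = subst (_≤ M) (sym suc-t) (N∸r≤M M≤r)
      suc-t≡fold-r : suc t ≡ fold r
      suc-t≡fold-r = trans suc-t (sym (fold-≥ M≤r))
      fold-suc-r≡t : fold (suc r % N) ≡ t
      fold-suc-r≡t with m≤n⇒m<n∨m≡n r<N
      ... | inj₁ suc-r<N = trans (cong fold (m<n⇒m%n≡m suc-r<N)) (fold-≥ (≤-trans M≤r (n≤1+n r)))
      ... | inj₂ suc-r≡N = trans (cong (λ u → fold (u % N)) suc-r≡N)
                                 (trans (cong fold (n%n≡0 N)) (sym (trans (cong (N ∸_) suc-r≡N) (n∸n≡0 N))))

  lookup-inject₁ : ∀ (z : Vec (Fin n) (suc M)) (t : Fin M) → z H.‼ toℕ t ≡ Vec.lookup z (inject₁ t)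
  lookup-inject₁ z t = trans (cong (z H.‼_) (sym (Finₚ.toℕ-inject₁ t))) (H.‼-toℕ z (inject₁ t))

  halfPath⇒isPath : ∀ z → IsHalfPath z → IsPath (Vec.head z) (Vec.tail z)
  halfPath⇒isPath z@(i Vec.∷ u) path = steps⇒isPath i u (λ t →
    subst₂ _~_ (lookup-inject₁ z t) (H.‼-toℕ z (Fin.suc t)) (path (toℕ t) (Finₚ.toℕ<n t)))

  isPath⇒halfPath : ∀ z → IsPath (Vec.head z) (Vec.tail z) → IsHalfPath z
  isPath⇒halfPath z@(i Vec.∷ u) isPath t t<M = subst₂ _~_
    (trans (sym (lookup-inject₁ z t′)) (cong (z H.‼_) (Finₚ.toℕ-fromℕ< t<M)))
    (trans (sym (H.‼-toℕ z (Fin.suc t′))) (cong (λ q → z H.‼ suc q) (Finₚ.toℕ-fromℕ< t<M)))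
    (isPath⇒steps i u isPath t′)
    where
    t′ = fromℕ< t<M

  closedWalk-unfold : ∀ z → closedWalk (unfold z) ≡ pathWeight (Vec.head z) (Vec.tail z)
  closedWalk-unfold z = trans
    (𝟙-cong (isClosedWalkᶠ? (unfold z)) (isPath? (Vec.head z) (Vec.tail z))
      (λ c → halfPath⇒isPath z (closed⇒halfPath z (closedᶠ⇒closed (unfold z) c)))
      (λ p i → halfPath⇒closed z (isPath⇒halfPath z p) (toℕ i)))
    (sym (pathWeight≡𝟙 (Vec.head z) (Vec.tail z)))

  fixedReflection-0≡∑-walksFrom : fixedReflection 0 ≡ ∑[ i ∈ allFin n ] walksFrom i M
  fixedReflection-0≡∑-walksFrom = begin
    ∑[ x ∈ words N ] (closedWalk x * 𝟙 (act (true , 0 mod N) x ≟ᵛ x))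
      ≡⟨ ∑-cong (words N) (λ x → *-comm (closedWalk x) _) ⟩
    ∑[ x ∈ words N ] (𝟙 (act (true , 0 mod N) x ≟ᵛ x) * closedWalk x)
      ≡⟨ Reindex.∑-reindex-onto _≟ᵛ_ _≟ᵛ_ (words N) (words (suc M)) (enumerates-words N) (enumerates-words (suc M))
           (λ x → act (true , 0 mod N) x ≟ᵛ x) unfold half unfold-fixed half-unfold unfold-half closedWalk ⟩
    ∑[ z ∈ words (suc M) ] closedWalk (unfold z)
      ≡⟨ ∑-cong (words (suc M)) closedWalk-unfold ⟩
    ∑[ z ∈ words (suc M) ] pathWeight (Vec.head z) (Vec.tail z)
      ≡⟨ Vectors.∑-vectors Finₚ._≟_ (allFin n) M _ ⟩
    ∑[ i ∈ allFin n ] walksFrom i M ∎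
    where open ≡-Reasoning

euler-trace-congruence : ∀ {n} (Γ : SimpleGraph n) → IsEuler Γ → ∀ M₁ → let N = suc (suc M₁) + suc (suc M₁) in
  2 * N ∣ trace (adjMatrix Γ ^ᴹ N) + properDivisorSum N (λ d N/d → φ N/d * trace (adjMatrix Γ ^ᴹ d))
euler-trace-congruence Γ euler M₁ =
  subst (2 * N ∣_) rotations≡traceSum
    (∣m+n∣m⇒∣n (subst (2 * N ∣_) (+-comm rotations reflections) 2N∣∑-fixedClosedWalks) 2N∣reflections)
  where
  M = suc (suc M₁)
  N = M + M
  open ClosedWalkAction Γ (suc (M₁ + M)) using (fixedClosedWalks; 2N∣∑-fixedClosedWalks)
  open RotationFixedPoints Γ (suc (M₁ + M)) using (fixed-rotation≡trace)
  open ReflectionFixedPoints Γ (M₁ + M) using (∑-fixedReflection)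
  open Palindromes Γ M₁ using (fixedReflection-0≡∑-walksFrom)

  trA : ℕ → ℕ
  trA d = trace (adjMatrix Γ ^ᴹ d)

  rotations reflections : ℕ
  rotations   = ∑[ k ∈ allFin N ] fixedClosedWalks (false , k)
  reflections = ∑[ k ∈ allFin N ] fixedClosedWalks (true , k)

  rotations≡traceSum : rotations ≡ trA N + properDivisorSum N (λ d N/d → φ N/d * trA d)
  rotations≡traceSum = trans (∑-cong (allFin N) fixed-rotation≡trace) (∑-gcd≡properDivisorSum (M₁ + M) trA)

  2N∣reflections : 2 * N ∣ reflections
  2N∣reflections with subst (4 ∣_) (sym fixedReflection-0≡∑-walksFrom) (Walks.4∣∑-walksFrom Γ euler M₁)
  ... | divides t eq = divides t (trans (∑-fixedReflection M refl) (trans (cong (M *_) eq) (ring M t)))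
    where
    ring : ∀ m t → m * (t * 4) ≡ t * (2 * (m + m))
    ring = solve-∀

even≥4 : ∀ {N} → N ≥ 4 → 2 ∣ N → Σ[ M₁ ∈ ℕ ] N ≡ suc (suc M₁) + suc (suc M₁)
even≥4 (s≤s (s≤s (s≤s (s≤s _)))) (divides 0 ())
even≥4 (s≤s (s≤s (s≤s (s≤s _)))) (divides 1 ())
even≥4 _ (divides (suc (suc M₁)) N≡M*2) = M₁ , trans N≡M*2 (ring M₁)
  where
  ring : ∀ m → suc (suc m) * 2 ≡ suc (suc m) + suc (suc m)
  ring = solve-∀

open import Data.Integer using (ℤ; +_; -_; _-_)
import Data.Integer as ℤ
import Data.Integer.Divisibility as ℤD
import Data.Integer.Properties as ℤₚ

∣+⇒ℤ∣ : ∀ d a b → d ∣ a + b → (+ d) ℤD.∣ ((+ a) - (- (+ b)))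
∣+⇒ℤ∣ d a b d∣a+b = subst (λ i → d ∣ ℤ.∣ (+ a) ℤ.+ i ∣) (sym (ℤₚ.neg-involutive (+ b))) d∣a+b

lemma2p7 : ∀ {n} (G : SimpleGraph n) → IsEuler G →
    (N : ℕ) → N ≥ 4 → 2 ∣ N →
    (+ (2 * N)) ℤD.∣ ((+ trace (adjMatrix G ^ᴹ N))
       - (- (+ properDivisorSum N (λ d Nd → φ Nd * trace (adjMatrix G ^ᴹ d)))))
lemma2p7 G euler N N≥4 2∣N with even≥4 N≥4 2∣N
... | M₁ , refl = ∣+⇒ℤ∣ (2 * N) (trace (adjMatrix G ^ᴹ N)) (properDivisorSum N (λ d Nd → φ Nd * trace (adjMatrix G ^ᴹ d)))
                         (euler-trace-congruence G euler M₁)
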